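{- For all partitions $\lambda,\mu$ of $n$ with $\lambda\neq\mu$, the map $\chi_{\lambda,\mu}$ defined in the context is a sign-reversing involution on $B_{\lambda,\mu}$, i.e. $\chi_{\lambda,\mu}$ maps $B_{\lambda,\mu}$ to itself, $\chi_{\lambda,\mu}\circ\chi_{\lambda,\mu}$ is the identity, and whenever $\chi_{\lambda,\mu}(S,T)=(U,V)\neq(S,T)$ we have $\operatorname{sgn}(V)=-\operatorname{sgn}(T)$.
   Context: For a partition $\lambda=(\lambda_1\ge\dots\ge\lambda_\ell>0)$, a semistandard Young tableau (SSYT) of shape $\lambda$ is a filling of the cells $(i,j)$, $1\le j\le\lambda_i$, by positive integers, weakly increasing along rows (left to right) and strictly increasing down columns; its content is the weak composition counting entries of each value. Permutations are in one-line notation, $s_i=(i,i+1)$, products compose right to left. Tunnel hook coverings (THCs), introduced by Allen and Mason; only these facts are needed: for a composition (sequence of positive integers) $\mu=(\mu_1,\dots,\mu_\ell)$, each THC $T$ of shape $\mu$ has a permutation $\operatorname{perm}(T)\in S_\ell$, and $T\mapsto\operatorname{perm}(T)$ is a bijection from THCs of shape $\mu$ onto $S_\ell$; $\operatorname{sgn}(T)=\operatorname{sgn}(\operatorname{perm}(T))$; $\Delta_i(T)=\mu_i+\sigma_i-i$ for $\sigma=\operatorname{perm}(T)$. For partitions $\lambda,\mu$ of $n$, $B_{\lambda,\mu}$ is the set of pairs $(S,T)$ where $S$ is an SSYT of shape $\lambda$, $T$ is a THC of shape $\mu$, and the content of $S$ is $(\Delta_{\sigma^{ -1}(1)}(T),\Delta_{\sigma^{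 -1}(2)}(T),\dots,\Delta_{\sigma^{ -1}(\ell(\mu))}(T))$ with $\sigma=\operatorname{perm}(T)$. Bender–Knuth involution for values $a$ and $a+1$ on an SSYT: an entry $a$ and an entry $a+1$ lying in the same column are called paired; in each row the unpaired entries equal to $a$ or $a+1$ form a contiguous segment consisting of $r$ copies of $a$ followed by $s$ copies of $a+1$, and this segment is replaced by $s$ copies of $a$ followed by $r$ copies of $a+1$; all other entries are unchanged. The map $\chi_{\lambda,\mu}$: given $(S,T)\in B_{\lambda,\mu}$ with $\sigma=\operatorname{perm}(T)$: (1) For each row $i$, let $q_i$ be the largest entry of row $i$ of $S$; let $m$ be the smallest index with $q_m\ne m$, or $m=\ell(\lambda)$ if there is none. (2) If $m=\ell(\lambda)$, set $\chi_{\lambda,\mu}(S,T)=(S,T)$. (3) Otherwise ($q_m>m$): let $V$ be the THC of shape $\mu$ with $\operatorname{perm}(V)=s_{q_m-1}\sigma$; replace the leftmost occurrence of $q_m$ in row $m$ of $S$ by $q_m-1$ to obtain $S'$, and let $U$ be the result of applying the Bender–Knuth involution for the values $q_m-1,q_m$ to $S'$; set $\chi_{\lambda,\mu}(S,T)=(U,V)$. -}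

module Defs where

open import Data.Bool using (Bool; true; false; if_then_else_; _∧_; _∨_; not)
open import Data.Nat using (ℕ; zero; suc; _+_; _∸_; _≤_; _<_; _≡ᵇ_; _<ᵇ_)
open import Data.Integer as ℤ using (ℤ; +_)
open import Data.List using (List; []; _∷_; map; length; filter; upTo)
open import Data.Nat.ListAction using (sum)
open import Data.Bool.ListAction using (any)
open import Data.List.Relation.Unary.All using (All)
open import Data.List.Relation.Unary.Linked using (Linked)
open import Data.List.Relation.Binary.Permutation.Propositional using (_↭_)
open import Data.Maybe using (Maybe; just; nothing; maybe)
open import Data.Product using (_×_; _,_)
open import Relation.Binary.PropositionalEquality using (_≡_)

-- 0-based partial lookup
nth : {A : Set} → List A → ℕ → Maybe A
nth []       _       = nothing
nth (x ∷ xs) zero    = just x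
nth (x ∷ xs) (suc j) = nth xs j

-- 1-based total lookup in a list of naturals (default 0 out of range)
get₁ : List ℕ → ℕ → ℕ
get₁ xs zero    = 0
get₁ xs (suc i) = maybe (λ x → x) 0 (nth xs i)

-- 1-based lookup of a row (default empty row)
rowAt : List (List ℕ) → ℕ → List ℕ
rowAt S zero    = []
rowAt S (suc i) = maybe (λ r → r) [] (nth S i)

-- last (= largest, for a weakly increasing row) entry; 0 for empty row
lastOr0 : List ℕ → ℕ
lastOr0 []           = 0
lastOr0 (x ∷ [])     = x
lastOr0 (x ∷ y ∷ ys) = lastOr0 (y ∷ ys)

posOf : List ℕ → ℕ → ℕ
posOf []       v = 0
posOf (x ∷ xs) v = if x ≡ᵇ v then 1 else suc (posOf xs v)

IsPartition : ℕ → List ℕ → Set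
IsPartition n λ' = All (λ x → 1 ≤ x) λ' × Linked (λ x y → y ≤ x) λ' × sum λ' ≡ n

-- Tableaux: a filling is a list of rows (row 1 first), each a list of entries
-- (column 1 first).

Filling : Set
Filling = List (List ℕ)

-- entry in row i, column j (both 0-based)
entry : Filling → ℕ → ℕ → Maybe ℕ
entry S i j with nth S i
... | nothing = nothing
... | just r  = nth r j

IsSSYT : List ℕ → Filling → Set
IsSSYT λ' S =
  map length S ≡ λ'
  × All (All (λ x → 1 ≤ x)) S
  × All (Linked _≤_) S
  × (∀ i j x y → entry S i j ≡ just x → entry S (suc i) j ≡ just y → x < y)

contentOf : Filling → ℕ → ℕ
contentOf S v = sum (map (λ r → length (filter (λ x → x Data.Nat.≟ v) r)) S)

-- Tunnel hook coverings of shape μ, represented by their permutation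
-- perm(T) ∈ S_ℓ (a bijection), written in one-line notation as a list
-- (σ₁, …, σ_ℓ).

IsPerm : ℕ → List ℕ → Set
IsPerm ℓ σ = σ ↭ map suc (upTo ℓ)

inversions : List ℕ → ℕ
inversions []       = 0
inversions (x ∷ xs) = length (filter (λ y → y Data.Nat.<? x) xs) + inversions xs

sgnℕ : ℕ → ℤ
sgnℕ zero    = + 1
sgnℕ (suc k) = ℤ.- sgnℕ k

sgn : List ℕ → ℤ
sgn σ = sgnℕ (inversions σ)

-- Δ_i(T) = μ_i + σ_i - i   (1-based i)
Δ : List ℕ → List ℕ → ℕ → ℤ
Δ μ σ i = (+ get₁ μ i ℤ.+ + get₁ σ i) ℤ.- + i

-- s_k σ  (product right to left): swap the values k and k+1 in the one-line word
sσ : ℕ → List ℕ → List ℕ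
sσ k σ = map (λ x → if x ≡ᵇ k then suc k else if x ≡ᵇ suc k then k else x) σ

-- The set B_{λ,μ}; a pair (S,T) is stored as (S , perm T).

Pair : Set
Pair = Filling × List ℕ

InB : List ℕ → List ℕ → Pair → Set
InB λ' μ (S , σ) =
  IsSSYT λ' S
  × IsPerm (length μ) σ
  × (∀ v → 1 ≤ v → v ≤ length μ → + contentOf S v ≡ Δ μ σ (posOf σ v))
  × (∀ v → length μ < v → contentOf S v ≡ 0)

colHas : Filling → ℕ → ℕ → Bool
colHas S j v = any (λ r → maybe (λ x → x ≡ᵇ v) false (nth r j)) S

unpaired : Filling → ℕ → ℕ → ℕ → Bool
unpaired S a j x =
  ((x ≡ᵇ a) ∧ not (colHas S j (suc a))) ∨ ((x ≡ᵇ suc a) ∧ not (colHas S j a))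

countUnp : Filling → ℕ → ℕ → ℕ → List ℕ → ℕ
countUnp S a v j []       = 0
countUnp S a v j (x ∷ xs) =
  (if unpaired S a j x ∧ (x ≡ᵇ v) then 1 else 0) + countUnp S a v (suc j) xs

-- rewrite the unpaired entries (left to right, t counts those seen so far)
-- as s copies of a followed by the rest as a+1
rewriteRow : Filling → ℕ → ℕ → ℕ → ℕ → List ℕ → List ℕ
rewriteRow S a s j t []       = []
rewriteRow S a s j t (x ∷ xs) =
  if unpaired S a j x
  then (if t <ᵇ s then a else suc a) ∷ rewriteRow S a s (suc j) (suc t) xs
  else x ∷ rewriteRow S a s (suc j) t xs

bkRow : Filling → ℕ → List ℕ → List ℕ
bkRow S a r = rewriteRow S a (countUnp S a (suc a) 0 r) 0 0 r

BK : ℕ → Filling → Filling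
BK a S = map (bkRow S a) S

-- smallest (1-based) row index m with q_m ≠ m, or ℓ(λ) if none
findM : List ℕ → Filling → ℕ
findM λ' S = go 1 S
  where
  go : ℕ → Filling → ℕ
  go i []       = length λ'
  go i (r ∷ rs) = if lastOr0 r ≡ᵇ i then go (suc i) rs else i

replaceLeftmost : ℕ → List ℕ → List ℕ
replaceLeftmost k []       = []
replaceLeftmost k (x ∷ xs) = if x ≡ᵇ k then (k ∸ 1) ∷ xs else x ∷ replaceLeftmost k xs

-- apply f to row m (1-based)
updRow : ℕ → (List ℕ → List ℕ) → Filling → Filling
updRow zero          f S        = S
updRow (suc m)       f []       = []
updRow (suc zero)    f (r ∷ S)  = f r ∷ S
updRow (suc (suc m)) f (r ∷ S)  = r ∷ updRow (suc m) f S

χ : List ℕ → List ℕ → Pair → Pair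
χ λ' μ (S , σ) =
  if m ≡ᵇ length λ'
  then (S , σ)
  else (BK (q ∸ 1) (updRow m (replaceLeftmost q) S) , sσ (q ∸ 1) σ)
  where
  m = findM λ' S
  q = lastOr0 (rowAt S m)

module Submission where

open import Data.Bool using (Bool; true; false; if_then_else_; _∧_; _∨_; T)
open import Data.Bool.Properties using (∧-zeroʳ; ∧-identityʳ; ∧-comm; ∨-zeroʳ; T-≡; ⇔→≡)
open import Data.Empty using (⊥-elim)
open import Data.Integer using (-_)
import Data.Integer as ℤ
open import Data.Integer.Solver using (module +-*-Solver)
import Data.Integer.Properties as ℤ
open import Data.List using (List; []; _∷_; length; filter; map; upTo; applyUpTo)
open import Data.List.Properties using (map-∘; map-id; map-applyUpTo)
open import Data.List.Relation.Unary.All using (All; []; _∷_)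
import Data.List.Relation.Unary.All as All
open import Data.List.Relation.Unary.Linked using (Linked; []; [-]; _∷_)
import Data.List.Relation.Unary.Linked as Linked
open import Data.List.Relation.Unary.Linked.Properties using (Linked⇒All)
open import Data.List.Relation.Binary.Permutation.Propositional using (_↭_; prep; swap; ↭-refl; ↭-trans)
open import Data.List.Relation.Binary.Permutation.Propositional.Properties using (map⁺; filter-↭; ↭-length)
open import Data.Maybe using (Maybe; just; nothing; maybe)
open import Data.Maybe.Properties using (just-injective)
import Data.Maybe as Maybe
open import Data.Nat using (ℕ; zero; suc; _+_; _∸_; _*_; _≤_; _<_; _≡ᵇ_; _<ᵇ_; z≤n; s≤s; _≟_; _<?_; _≤?_)
open import Data.Nat.Properties
open import Algebra.Properties.CommutativeSemigroup +-commutativeSemigroup using (interchange; x∙yz≈y∙xz; xy∙z≈xz∙y; xy∙z≈zy∙x)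
open import Data.Nat.ListAction using (sum)
open import Data.Product using (∃-syntax; _×_; _,_; proj₁; proj₂)
open import Data.Sum using (_⊎_; inj₁; inj₂)
open import Function using (_∘_; id; case_of_; mk⇔; Equivalence)
open import Relation.Binary.PropositionalEquality
open import Relation.Binary.Definitions using (tri<; tri≈; tri>)
open import Relation.Nullary using (yes; no; contradiction)
open import Defs

-- Let m be the first row of S whose largest entry q = a+1 differs from m, so that rows above m
-- end in their index and contain only entries < a. Lowering the leftmost a+1 of row m keeps S
-- semistandard and pairs no new column (a directly above a+1). Bender–Knuth for a, a+1 only
-- rewrites the unpaired a's and (a+1)'s, which form a block inside each row; it preserves the
-- pairing, hence is an involution, and exchanges the contents of a and a+1. The rows above m are
-- untouched and row m again ends in a+1, so χ finds the same m and q on the image and undoes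
-- both steps. The content of the image is that of S permuted by s_a, matching Δ for s_a σ, and
-- s_a σ has one inversion more or less than σ.

𝟙 : Bool → ℕ
𝟙 b = if b then 1 else 0

∧-true : ∀ {b c} → (b ∧ c) ≡ true → b ≡ true × c ≡ true
∧-true {true} {true} _ = refl , refl

≡ᵇ-refl : ∀ n → (n ≡ᵇ n) ≡ true
≡ᵇ-refl zero    = refl
≡ᵇ-refl (suc n) = ≡ᵇ-refl n

≡ᵇ-sound : ∀ {m n} → (m ≡ᵇ n) ≡ true → m ≡ n
≡ᵇ-sound {m} {n} e = ≡ᵇ⇒≡ m n (Equivalence.from T-≡ e)

≡ᵇ-false⇒≢ : ∀ {m n} → (m ≡ᵇ n) ≡ false → m ≢ n
≡ᵇ-false⇒≢ {m} e refl = contradiction (trans (sym (≡ᵇ-refl m)) e) λ ()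

≢⇒≡ᵇ-false : ∀ {m n} → m ≢ n → (m ≡ᵇ n) ≡ false
≢⇒≡ᵇ-false {m} {n} m≢n with m ≡ᵇ n in e
... | true  = ⊥-elim (m≢n (≡ᵇ-sound e))
... | false = refl

1+n≡ᵇn : ∀ n → (suc n ≡ᵇ n) ≡ false
1+n≡ᵇn n = ≢⇒≡ᵇ-false {suc n} 1+n≢n

n≡ᵇ1+n : ∀ n → (n ≡ᵇ suc n) ≡ false
n≡ᵇ1+n n = ≢⇒≡ᵇ-false {n} (1+n≢n ∘ sym)

<ᵇ-sound : ∀ {m n} → (m <ᵇ n) ≡ true → m < n
<ᵇ-sound {m} {n} e = <ᵇ⇒< m n (Equivalence.from T-≡ e)

<ᵇ-false⇒≥ : ∀ {m n} → (m <ᵇ n) ≡ false → n ≤ m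
<ᵇ-false⇒≥ e = ≮⇒≥ (λ m<n → subst T e (<⇒<ᵇ m<n))

<⇒<ᵇ-true : ∀ {m n} → m < n → (m <ᵇ n) ≡ true
<⇒<ᵇ-true m<n = Equivalence.to T-≡ (<⇒<ᵇ m<n)

≥⇒<ᵇ-false : ∀ {m n} → n ≤ m → (m <ᵇ n) ≡ false
≥⇒<ᵇ-false {m} {n} n≤m with m <ᵇ n in e
... | true  = ⊥-elim (<⇒≱ (<ᵇ-sound e) n≤m)
... | false = refl

+-exchange : ∀ x y z → x + (y + z) ≡ y + (x + z)
+-exchange = x∙yz≈y∙xz

+-exchangeʳ : ∀ x y z → x + y + z ≡ x + z + y
+-exchangeʳ = xy∙z≈xz∙y

∸-suc : ∀ {s t} → t < s → s ∸ t ≡ suc (s ∸ suc t)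
∸-suc t<s = +-∸-assoc 1 t<s

nth-map : ∀ {A B : Set} (f : A → B) xs k → nth (map f xs) k ≡ Maybe.map f (nth xs k)
nth-map f []       k       = refl
nth-map f (x ∷ xs) zero    = refl
nth-map f (x ∷ xs) (suc k) = nth-map f xs k

nth-map-just : ∀ {A B : Set} (f : A → B) xs k {x} → nth xs k ≡ just x → nth (map f xs) k ≡ just (f x)
nth-map-just f xs k e = trans (nth-map f xs k) (cong (Maybe.map f) e)

nth-map-just⁻ : ∀ {A B : Set} (f : A → B) xs k {y} → nth (map f xs) k ≡ just y →
                ∃[ x ] nth xs k ≡ just x × y ≡ f x
nth-map-just⁻ f xs k e rewrite nth-map f xs k with nth xs k
nth-map-just⁻ f xs k refl | just x = x , refl , refl

nth-just⇒< : ∀ {A : Set} (xs : List A) k {x} → nth xs k ≡ just x → k < length xs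
nth-just⇒< (x ∷ xs) zero    e = s≤s z≤n
nth-just⇒< (x ∷ xs) (suc k) e = s≤s (nth-just⇒< xs k e)

<⇒nth-just : ∀ {A : Set} (xs : List A) k → k < length xs → ∃[ x ] nth xs k ≡ just x
<⇒nth-just (x ∷ xs) zero    _         = x , refl
<⇒nth-just (x ∷ xs) (suc k) (s≤s k<n) = <⇒nth-just xs k k<n

nth-just-≤ : ∀ {A : Set} (xs : List A) {k k′ x} → k′ ≤ k → nth xs k ≡ just x → ∃[ y ] nth xs k′ ≡ just y
nth-just-≤ xs k′≤k e = <⇒nth-just xs _ (≤-<-trans k′≤k (nth-just⇒< xs _ e))

All-nth : ∀ {A : Set} {P : A → Set} {xs} k {x} → All P xs → nth xs k ≡ just x → P x
All-nth zero    (p ∷ ps) refl = p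
All-nth (suc k) (p ∷ ps) e    = All-nth k ps e

nth⇒All : ∀ {A : Set} {P : A → Set} xs → (∀ k {x} → nth xs k ≡ just x → P x) → All P xs
nth⇒All []       h = []
nth⇒All (x ∷ xs) h = h 0 refl ∷ nth⇒All xs (h ∘ suc)

Linked-nth : ∀ {A : Set} {R : A → A → Set} {xs} k {x y} → Linked R xs →
             nth xs k ≡ just x → nth xs (suc k) ≡ just y → R x y
Linked-nth zero    (Rxy ∷ _) refl refl = Rxy
Linked-nth (suc k) (_ ∷ l)   e₁   e₂   = Linked-nth k l e₁ e₂

Linked-≤-head : ∀ {x xs} → Linked _≤_ (x ∷ xs) → All (x ≤_) xs
Linked-≤-head l = All.tail (Linked⇒All ≤-trans ≤-refl l)

nth-ext : ∀ {A : Set} (xs ys : List A) → (∀ k → nth xs k ≡ nth ys k) → xs ≡ ys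
nth-ext []       []       h = refl
nth-ext []       (y ∷ ys) h with () ← h 0
nth-ext (x ∷ xs) []       h with () ← h 0
nth-ext (x ∷ xs) (y ∷ ys) h with refl ← h 0 = cong (x ∷_) (nth-ext xs ys (h ∘ suc))

map-cong-nth : ∀ {A B : Set} {f g : A → B} xs → (∀ k {x} → nth xs k ≡ just x → f x ≡ g x) → map f xs ≡ map g xs
map-cong-nth []       h = refl
map-cong-nth (x ∷ xs) h = cong₂ _∷_ (h 0 refl) (map-cong-nth xs (h ∘ suc))

entry-just : ∀ S i j {r} → nth S i ≡ just r → entry S i j ≡ nth r j
entry-just S i j e with nth S i
entry-just S i j refl | just r = refl

entry-≡ : ∀ X Y i j → nth X i ≡ nth Y i → entry X i j ≡ entry Y i j
entry-≡ X Y i j e with nth X i | nth Y i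
entry-≡ X Y i j refl | just r  | .(just r) = refl
entry-≡ X Y i j refl | nothing | .nothing  = refl

entry-row : ∀ S i j {x} → entry S i j ≡ just x → ∃[ r ] nth S i ≡ just r × nth r j ≡ just x
entry-row S i j e with nth S i
... | just r = r , refl , e

Occurs : ℕ → List ℕ → Set
Occurs v r = ∃[ j ] nth r j ≡ just v

count : ℕ → List ℕ → ℕ
count v r = length (filter (_≟ v) r)

count-∷ : ∀ v x xs → count v (x ∷ xs) ≡ 𝟙 (x ≡ᵇ v) + count v xs
count-∷ v x xs with x ≡ᵇ v
... | true  = refl
... | false = refl

count-↭ : ∀ v {xs ys} → xs ↭ ys → count v xs ≡ count v ys
count-↭ v p = ↭-length (filter-↭ (_≟ v) p)

Occurs⇒count : ∀ v xs → Occurs v xs → 1 ≤ count v xs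
Occurs⇒count v (x ∷ xs) (zero  , refl) rewrite count-∷ v v xs | ≡ᵇ-refl v = s≤s z≤n
Occurs⇒count v (x ∷ xs) (suc k , e)    rewrite count-∷ v x xs = ≤-trans (Occurs⇒count v xs (k , e)) (m≤n+m _ _)

count⇒Occurs : ∀ v xs → 1 ≤ count v xs → Occurs v xs
count⇒Occurs v (x ∷ xs) 1≤c rewrite count-∷ v x xs with x ≡ᵇ v in e
... | true  = zero , cong just (≡ᵇ-sound e)
... | false = let (k , p) = count⇒Occurs v xs 1≤c in suc k , p

sum-map-+ : ∀ {A : Set} (f g : A → ℕ) xs → sum (map (λ x → f x + g x) xs) ≡ sum (map f xs) + sum (map g xs)
sum-map-+ f g []       = refl
sum-map-+ f g (x ∷ xs) = trans (cong (f x + g x +_) (sum-map-+ f g xs)) (interchange (f x) (g x) _ _)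

sum-map-cong : ∀ {A : Set} {f g : A → ℕ} xs → (∀ x → f x ≡ g x) → sum (map f xs) ≡ sum (map g xs)
sum-map-cong xs h = cong sum (map-cong-nth xs (λ _ {x} _ → h x))

sum-map-nth : ∀ {A : Set} (f : A → ℕ) xs k {x} → nth xs k ≡ just x → f x ≤ sum (map f xs)
sum-map-nth f (x ∷ xs) zero    refl = m≤m+n (f x) _
sum-map-nth f (y ∷ xs) (suc k) e    = ≤-trans (sum-map-nth f xs k e) (m≤n+m _ (f y))

-- Flipping the free a's and (a+1)'s of a row

involved : ℕ → ℕ → Bool
involved a x = (x ≡ᵇ a) ∨ (x ≡ᵇ suc a)

data Involvement (a x : ℕ) : Set where
  is-a       : x ≡ a → Involvement a x
  is-a+1     : x ≡ suc a → Involvement a x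
  uninvolved : involved a x ≡ false → Involvement a x

involvement : ∀ a x → Involvement a x
involvement a x with x ≡ᵇ a in e₁ | x ≡ᵇ suc a in e₂
... | true  | _     = is-a (≡ᵇ-sound e₁)
... | false | true  = is-a+1 (≡ᵇ-sound e₂)
... | false | false = uninvolved (cong₂ _∨_ e₁ e₂)

involved-a : ∀ a → involved a a ≡ true
involved-a a rewrite ≡ᵇ-refl a = refl

involved-a+1 : ∀ a → involved a (suc a) ≡ true
involved-a+1 a rewrite ≡ᵇ-refl a = ∨-zeroʳ (suc a ≡ᵇ a)

uninvolved⇒≢ : ∀ {a x} → involved a x ≡ false → x ≢ a × x ≢ suc a
uninvolved⇒≢ {a} {x} e with x ≡ᵇ a in e₁
... | false = ≡ᵇ-false⇒≢ e₁ , ≡ᵇ-false⇒≢ e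
... | true with () ← e

≢⇒uninvolved : ∀ {a x} → x ≢ a → x ≢ suc a → involved a x ≡ false
≢⇒uninvolved x≢a x≢a+1 = cong₂ _∨_ (≢⇒≡ᵇ-false x≢a) (≢⇒≡ᵇ-false x≢a+1)

uninvolved≤a+1⇒<a : ∀ {a x} → involved a x ≡ false → x ≤ suc a → x < a
uninvolved≤a+1⇒<a e x≤a+1 = let (x≢a , x≢a+1) = uninvolved⇒≢ e in ≤∧≢⇒< (≤-pred (≤∧≢⇒< x≤a+1 x≢a+1)) x≢a

uninvolved≥a⇒>a+1 : ∀ {a y} → involved a y ≡ false → a ≤ y → suc (suc a) ≤ y
uninvolved≥a⇒>a+1 e a≤y = let (y≢a , y≢a+1) = uninvolved⇒≢ e in ≤∧≢⇒< (≤∧≢⇒< a≤y (y≢a ∘ sym)) (y≢a+1 ∘ sym)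

-- p tells whether the entry's column is paired; free entries are unpaired a's and (a+1)'s.
free : Bool → ℕ → ℕ → Bool
free true  a x = false
free false a x = involved a x

-- The value written into the t-th free position when s of them become a.
slot : ℕ → ℕ → ℕ → ℕ
slot a s t = if t <ᵇ s then a else suc a

flipEntry : Bool → ℕ → ℕ → ℕ → ℕ → ℕ
flipEntry p a s t x = if free p a x then slot a s t else x

advance : Bool → ℕ → ℕ → ℕ → ℕ
advance p a t x = if free p a x then suc t else t

flipFrom : (ℕ → Bool) → ℕ → ℕ → ℕ → List ℕ → List ℕ
flipFrom P a s t []       = []
flipFrom P a s t (x ∷ xs) = flipEntry (P 0) a s t x ∷ flipFrom (P ∘ suc) a s (advance (P 0) a t x) xs

countAt : (ℕ → ℕ → Bool) → List ℕ → ℕ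
countAt f []       = 0
countAt f (x ∷ xs) = 𝟙 (f 0 x) + countAt (f ∘ suc) xs

#free #free-a #free-a+1 #paired-a #paired-a+1 : (ℕ → Bool) → ℕ → List ℕ → ℕ
#free       P a = countAt (λ k x → free (P k) a x)
#free-a     P a = countAt (λ k x → free (P k) a x ∧ (x ≡ᵇ a))
#free-a+1   P a = countAt (λ k x → free (P k) a x ∧ (x ≡ᵇ suc a))
#paired-a   P a = countAt (λ k x → (x ≡ᵇ a) ∧ P k)
#paired-a+1 P a = countAt (λ k x → (x ≡ᵇ suc a) ∧ P k)

flipRow : (ℕ → Bool) → ℕ → List ℕ → List ℕ
flipRow P a r = flipFrom P a (#free-a+1 P a r) 0 r

flipEntry-a : ∀ a s t → flipEntry false a s t a ≡ slot a s t
flipEntry-a a s t rewrite involved-a a = refl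

flipEntry-a+1 : ∀ a s t → flipEntry false a s t (suc a) ≡ slot a s t
flipEntry-a+1 a s t rewrite involved-a+1 a = refl

flipEntry-uninvolved : ∀ p a s t x → involved a x ≡ false → flipEntry p a s t x ≡ x
flipEntry-uninvolved true  a s t x e = refl
flipEntry-uninvolved false a s t x e rewrite e = refl

advance-a : ∀ a t → advance false a t a ≡ suc t
advance-a a t rewrite involved-a a = refl

advance-a+1 : ∀ a t → advance false a t (suc a) ≡ suc t
advance-a+1 a t rewrite involved-a+1 a = refl

advance-uninvolved : ∀ p a t x → involved a x ≡ false → advance p a t x ≡ t
advance-uninvolved true  a t x e = refl
advance-uninvolved false a t x e rewrite e = refl

involved-slot : ∀ a s t → involved a (slot a s t) ≡ true
involved-slot a s t with t <ᵇ s
... | true  = involved-a a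
... | false = involved-a+1 a

a≤slot : ∀ a s t → a ≤ slot a s t
a≤slot a s t with t <ᵇ s
... | true  = ≤-refl
... | false = n≤1+n a

slot≤a+1 : ∀ a s t → slot a s t ≤ suc a
slot≤a+1 a s t with t <ᵇ s
... | true  = n≤1+n a
... | false = ≤-refl

slot-mono : ∀ a s t → slot a s t ≤ slot a s (suc t)
slot-mono a s t with t <ᵇ s in e
... | true  = a≤slot a s (suc t)
... | false rewrite ≥⇒<ᵇ-false {suc t} {s} (≤-trans (<ᵇ-false⇒≥ e) (n≤1+n t)) = ≤-refl

involved-flipEntry : ∀ p a s t x → involved a (flipEntry p a s t x) ≡ involved a x
involved-flipEntry true  a s t x = refl
involved-flipEntry false a s t x with involved a x in e
... | true  = involved-slot a s t
... | false = e

flipFrom-cong : ∀ {P Q : ℕ → Bool} a s t r → (∀ k → P k ≡ Q k) → flipFrom P a s t r ≡ flipFrom Q a s t r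
flipFrom-cong a s t []       P≗Q = refl
flipFrom-cong {P} {Q} a s t (x ∷ xs) P≗Q rewrite P≗Q 0 =
  cong (flipEntry (Q 0) a s t x ∷_) (flipFrom-cong a s (advance (Q 0) a t x) xs (P≗Q ∘ suc))

countAt-cong : ∀ {f g : ℕ → ℕ → Bool} r → (∀ k {x} → nth r k ≡ just x → f k x ≡ g k x) → countAt f r ≡ countAt g r
countAt-cong []       h = refl
countAt-cong (x ∷ xs) h rewrite h 0 refl = cong (_ +_) (countAt-cong xs (h ∘ suc))

flipRow-cong : ∀ {P Q : ℕ → Bool} a r → (∀ k → P k ≡ Q k) → flipRow P a r ≡ flipRow Q a r
flipRow-cong a r P≗Q =
  trans (cong (λ c → flipFrom _ a c 0 r) (countAt-cong r (λ k {x} _ → cong (λ b → free b a x ∧ (x ≡ᵇ suc a)) (P≗Q k))))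
        (flipFrom-cong a _ 0 r P≗Q)

length-flipFrom : ∀ P a s t r → length (flipFrom P a s t r) ≡ length r
length-flipFrom P a s t []       = refl
length-flipFrom P a s t (x ∷ xs) = cong suc (length-flipFrom (P ∘ suc) a s _ xs)

nth-flipFrom : ∀ P a s t r k {x} → nth r k ≡ just x →
               ∃[ t′ ] nth (flipFrom P a s t r) k ≡ just (flipEntry (P k) a s t′ x)
nth-flipFrom P a s t (x ∷ xs) zero    refl = t , refl
nth-flipFrom P a s t (x ∷ xs) (suc k) e    = nth-flipFrom (P ∘ suc) a s _ xs k e

nth-flipFrom⁻ : ∀ P a s t r k {y} → nth (flipFrom P a s t r) k ≡ just y →
                ∃[ x ] nth r k ≡ just x × ∃[ t′ ] y ≡ flipEntry (P k) a s t′ x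
nth-flipFrom⁻ P a s t (x ∷ xs) zero    refl = x , refl , t , refl
nth-flipFrom⁻ P a s t (x ∷ xs) (suc k) e    = nth-flipFrom⁻ (P ∘ suc) a s _ xs k e

flipFrom-uninvolved : ∀ P a s t r → All (λ x → involved a x ≡ false) r → flipFrom P a s t r ≡ r
flipFrom-uninvolved P a s t []       []       = refl
flipFrom-uninvolved P a s t (x ∷ xs) (e ∷ es)
  rewrite flipEntry-uninvolved (P 0) a s t x e | advance-uninvolved (P 0) a t x e =
  cong (x ∷_) (flipFrom-uninvolved (P ∘ suc) a s t xs es)

flipEntry-pos : ∀ p a s t x → 1 ≤ a → 1 ≤ x → 1 ≤ flipEntry p a s t x
flipEntry-pos true  a s t x 1≤a 1≤x = 1≤x
flipEntry-pos false a s t x 1≤a 1≤x with involved a x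
... | true  = ≤-trans 1≤a (a≤slot a s t)
... | false = 1≤x

flipFrom-pos : ∀ P a s t r → 1 ≤ a → All (1 ≤_) r → All (1 ≤_) (flipFrom P a s t r)
flipFrom-pos P a s t []       1≤a []         = []
flipFrom-pos P a s t (x ∷ xs) 1≤a (1≤x ∷ ps) = flipEntry-pos (P 0) a s t x 1≤a 1≤x ∷ flipFrom-pos (P ∘ suc) a s _ xs 1≤a ps

flipEntry-≤a+1 : ∀ p a s t x → x ≤ suc a → flipEntry p a s t x ≤ suc a
flipEntry-≤a+1 true  a s t x x≤a+1 = x≤a+1
flipEntry-≤a+1 false a s t x x≤a+1 with involved a x
... | true  = slot≤a+1 a s t
... | false = x≤a+1

flipEntry-overwrite : ∀ p a c s t x → flipEntry p a c t (flipEntry p a s t x) ≡ flipEntry p a c t x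
flipEntry-overwrite true  a c s t x = refl
flipEntry-overwrite false a c s t x with involved a x in e
... | true  rewrite involved-slot a s t = refl
... | false rewrite e = refl

advance-flipEntry : ∀ p a s t x → advance p a t (flipEntry p a s t x) ≡ advance p a t x
advance-flipEntry p a s t x = cong (λ b → if b then suc t else t) (free-flipEntry p)
  where
  free-flipEntry : ∀ p → free p a (flipEntry p a s t x) ≡ free p a x
  free-flipEntry true  = refl
  free-flipEntry false = involved-flipEntry false a s t x

-- Only the positions of the free entries matter, not their current values.
flipFrom-overwrite : ∀ P a c s t r → flipFrom P a c t (flipFrom P a s t r) ≡ flipFrom P a c t r
flipFrom-overwrite P a c s t []       = refl
flipFrom-overwrite P a c s t (x ∷ xs) rewrite flipEntry-overwrite (P 0) a c s t x | advance-flipEntry (P 0) a s t x =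
  cong (flipEntry (P 0) a c t x ∷_) (flipFrom-overwrite (P ∘ suc) a c s (advance (P 0) a t x) xs)

#free-split : ∀ P a r → #free P a r ≡ #free-a P a r + #free-a+1 P a r
#free-split P a []       = refl
#free-split P a (x ∷ xs) with P 0
... | true  = #free-split (P ∘ suc) a xs
... | false with involvement a x
...   | uninvolved e rewrite e = #free-split (P ∘ suc) a xs
...   | is-a refl    rewrite involved-a a   | ≡ᵇ-refl a | n≡ᵇ1+n a = cong suc (#free-split (P ∘ suc) a xs)
...   | is-a+1 refl  rewrite involved-a+1 a | ≡ᵇ-refl a | 1+n≡ᵇn a =
  trans (cong suc (#free-split (P ∘ suc) a xs)) (sym (+-suc _ _))

𝟙-slot-a+1 : ∀ a s t {c} → 𝟙 (slot a s t ≡ᵇ suc a) + (c ∸ (s ∸ suc t)) ≡ suc c ∸ (s ∸ t)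
𝟙-slot-a+1 a s t {c} with t <ᵇ s in t<s
... | true  rewrite n≡ᵇ1+n a | ∸-suc (<ᵇ-sound {t} {s} t<s) = refl
... | false rewrite ≡ᵇ-refl a | m≤n⇒m∸n≡0 (<ᵇ-false⇒≥ {t} {s} t<s)
                  | m≤n⇒m∸n≡0 (≤-trans (<ᵇ-false⇒≥ {t} {s} t<s) (n≤1+n t)) = refl

#free-a+1-flipFrom : ∀ P a s t r → #free-a+1 P a (flipFrom P a s t r) ≡ #free P a r ∸ (s ∸ t)
#free-a+1-flipFrom P a s t []       = sym (0∸n≡0 (s ∸ t))
#free-a+1-flipFrom P a s t (x ∷ xs) with P 0
... | true = #free-a+1-flipFrom (P ∘ suc) a s t xs
... | false with involved a x in e
...   | false rewrite e = #free-a+1-flipFrom (P ∘ suc) a s t xs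
...   | true rewrite involved-slot a s t =
  trans (cong (_ +_) (#free-a+1-flipFrom (P ∘ suc) a s (suc t) xs)) (𝟙-slot-a+1 a s t)

#free-a-above : ∀ P a r → All (suc a ≤_) r → #free-a P a r ≡ 0
#free-a-above P a []       []         = refl
#free-a-above P a (x ∷ xs) (a<x ∷ a<xs) with P 0
... | true = #free-a-above (P ∘ suc) a xs a<xs
... | false with involvement a x
...   | uninvolved e rewrite e = #free-a-above (P ∘ suc) a xs a<xs
...   | is-a refl    = ⊥-elim (1+n≰n a<x)
...   | is-a+1 refl  rewrite involved-a+1 a | 1+n≡ᵇn a = #free-a-above (P ∘ suc) a xs a<xs

flipFrom-above-id : ∀ P a c t r → All (suc a ≤_) r → c ≤ t → flipFrom P a c t r ≡ r
flipFrom-above-id P a c t []       []         c≤t = refl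
flipFrom-above-id P a c t (x ∷ xs) (a<x ∷ a<xs) c≤t with P 0
... | true = cong (x ∷_) (flipFrom-above-id (P ∘ suc) a c t xs a<xs c≤t)
... | false with involvement a x
...   | uninvolved e rewrite flipEntry-uninvolved false a c t x e | advance-uninvolved false a t x e =
  cong (x ∷_) (flipFrom-above-id (P ∘ suc) a c t xs a<xs c≤t)
...   | is-a refl    = ⊥-elim (1+n≰n a<x)
...   | is-a+1 refl  rewrite flipEntry-a+1 a c t | advance-a+1 a t | ≥⇒<ᵇ-false {t} {c} c≤t =
  cong (suc a ∷_) (flipFrom-above-id (P ∘ suc) a c (suc t) xs a<xs (≤-trans c≤t (n≤1+n t)))

-- In a weakly increasing row the free a's precede the free (a+1)'s, so writing
-- #free-a many a's back leaves the row unchanged.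
flipFrom-sorted-id : ∀ P a c t r → Linked _≤_ r → t + #free-a P a r ≡ c → flipFrom P a c t r ≡ r
flipFrom-sorted-id P a c t []       _ _ = refl
flipFrom-sorted-id P a c t (x ∷ xs) l e with P 0
... | true = cong (x ∷_) (flipFrom-sorted-id (P ∘ suc) a c t xs (Linked.tail l) e)
... | false with involvement a x
...   | uninvolved ex rewrite flipEntry-uninvolved false a c t x ex | advance-uninvolved false a t x ex | ex =
  cong (x ∷_) (flipFrom-sorted-id (P ∘ suc) a c t xs (Linked.tail l) e)
...   | is-a refl rewrite flipEntry-a a c t | advance-a a t | involved-a a | ≡ᵇ-refl a
                        | <⇒<ᵇ-true (subst (t <_) e (m<m+n t (s≤s z≤n))) =
  cong (a ∷_) (flipFrom-sorted-id (P ∘ suc) a c (suc t) xs (Linked.tail l) (trans (sym (+-suc t _)) e))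
...   | is-a+1 refl rewrite flipEntry-a+1 a c t | advance-a+1 a t | involved-a+1 a | 1+n≡ᵇn a
                          | #free-a-above (P ∘ suc) a xs (Linked-≤-head l)
                          | +-identityʳ t | e =
  cong₂ _∷_ (cong (λ b → if b then a else suc a) (≥⇒<ᵇ-false {c} {c} ≤-refl))
            (flipFrom-above-id (P ∘ suc) a c (suc c) xs (Linked-≤-head l) (n≤1+n c))

flipRow-involutive : ∀ P a r → Linked _≤_ r → flipRow P a (flipRow P a r) ≡ r
flipRow-involutive P a r l = begin
  flipFrom P a (#free-a+1 P a (flipFrom P a s 0 r)) 0 (flipFrom P a s 0 r) ≡⟨ flipFrom-overwrite P a _ s 0 r ⟩
  flipFrom P a (#free-a+1 P a (flipFrom P a s 0 r)) 0 r                   ≡⟨ cong (λ c → flipFrom P a c 0 r) #a+1-after ⟩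
  flipFrom P a (#free-a P a r) 0 r                                          ≡⟨ flipFrom-sorted-id P a _ 0 r l refl ⟩
  r                                                                         ∎
  where
  open ≡-Reasoning
  s = #free-a+1 P a r
  #a+1-after : #free-a+1 P a (flipFrom P a s 0 r) ≡ #free-a P a r
  #a+1-after = trans (#free-a+1-flipFrom P a s 0 r) (trans (cong (_∸ s) (#free-split P a r)) (m+n∸n≡m _ s))

below-slot : ∀ {a x} s t → involved a x ≡ false → x ≤ suc a → x ≤ slot a s t
below-slot {a} s t ex x≤a+1 = ≤-trans (<⇒≤ (uninvolved≤a+1⇒<a ex x≤a+1)) (a≤slot a s t)

slot-below : ∀ {a y} s t → involved a y ≡ false → a ≤ y → slot a s t ≤ y
slot-below {a} s t ey a≤y = ≤-trans (slot≤a+1 a s t) (<⇒≤ (uninvolved≥a⇒>a+1 ey a≤y))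

slot-≤-flipEntry : ∀ a s t y → a ≤ y → slot a s t ≤ flipEntry false a s (suc t) y
slot-≤-flipEntry a s t y a≤y with involved a y in e
... | true  = slot-mono a s t
... | false = slot-below s t e a≤y

-- The side conditions say: among equal neighbours, paired a's come first and paired (a+1)'s last.
flipEntry-mono : ∀ p₀ p₁ a s t x y → x ≤ y →
                 (x ≡ a → y ≡ a → p₁ ≡ true → p₀ ≡ true) →
                 (x ≡ suc a → y ≡ suc a → p₀ ≡ true → p₁ ≡ true) →
                 flipEntry p₀ a s t x ≤ flipEntry p₁ a s (advance p₀ a t x) y
flipEntry-mono true true a s t x y x≤y c₁ c₂ = x≤y
flipEntry-mono true false a s t x y x≤y c₁ c₂ with involvement a y
... | uninvolved ey rewrite flipEntry-uninvolved false a s t y ey = x≤y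
... | is-a refl     rewrite flipEntry-a a s t = ≤-trans x≤y (a≤slot a s t)
... | is-a+1 refl   rewrite flipEntry-a+1 a s t with involvement a x
...   | uninvolved ex = below-slot s t ex x≤y
...   | is-a refl     = a≤slot a s t
...   | is-a+1 refl   with () ← c₂ refl refl refl
flipEntry-mono false true a s t x y x≤y c₁ c₂ with involvement a x
... | uninvolved ex rewrite flipEntry-uninvolved false a s t x ex = x≤y
... | is-a+1 refl   rewrite flipEntry-a+1 a s t = ≤-trans (slot≤a+1 a s t) x≤y
... | is-a refl     rewrite flipEntry-a a s t with involvement a y
...   | uninvolved ey = slot-below s t ey x≤y
...   | is-a+1 refl   = slot≤a+1 a s t
...   | is-a refl     with () ← c₁ refl refl refl
flipEntry-mono false false a s t x y x≤y c₁ c₂ with involvement a x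
... | is-a refl   rewrite flipEntry-a a s t   | advance-a a t   = slot-≤-flipEntry a s t y x≤y
... | is-a+1 refl rewrite flipEntry-a+1 a s t | advance-a+1 a t = slot-≤-flipEntry a s t y (≤-trans (n≤1+n a) x≤y)
... | uninvolved ex rewrite flipEntry-uninvolved false a s t x ex | advance-uninvolved false a t x ex
  with involvement a y
...   | uninvolved ey rewrite flipEntry-uninvolved false a s t y ey = x≤y
...   | is-a refl     rewrite flipEntry-a a s t   = ≤-trans x≤y (a≤slot a s t)
...   | is-a+1 refl   rewrite flipEntry-a+1 a s t = below-slot s t ex x≤y

PairedAtEnds : (ℕ → Bool) → ℕ → List ℕ → Set
PairedAtEnds P a r = ∀ k {x y} → nth r k ≡ just x → nth r (suc k) ≡ just y →
  (x ≡ a → y ≡ a → P (suc k) ≡ true → P k ≡ true) × (x ≡ suc a → y ≡ suc a → P k ≡ true → P (suc k) ≡ true)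

flipFrom-sorted : ∀ P a s t r → Linked _≤_ r → PairedAtEnds P a r → Linked _≤_ (flipFrom P a s t r)
flipFrom-sorted P a s t []           _          _   = []
flipFrom-sorted P a s t (x ∷ [])     _          _   = [-]
flipFrom-sorted P a s t (x ∷ y ∷ xs) (x≤y ∷ l) ends =
  let (c₁ , c₂) = ends 0 refl refl in
  flipEntry-mono (P 0) (P 1) a s t x y x≤y c₁ c₂ ∷ flipFrom-sorted (P ∘ suc) a s _ (y ∷ xs) l (ends ∘ suc)

slot-≡ᵇ-other : ∀ a s t {v} → v ≢ a → v ≢ suc a → (slot a s t ≡ᵇ v) ≡ false
slot-≡ᵇ-other a s t v≢a v≢a+1 with t <ᵇ s
... | true  = ≢⇒≡ᵇ-false (v≢a ∘ sym)
... | false = ≢⇒≡ᵇ-false (v≢a+1 ∘ sym)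

flipEntry-≡ᵇ-other : ∀ p a s t x {v} → v ≢ a → v ≢ suc a → (flipEntry p a s t x ≡ᵇ v) ≡ (x ≡ᵇ v)
flipEntry-≡ᵇ-other true  a s t x _ _ = refl
flipEntry-≡ᵇ-other false a s t x v≢a v≢a+1 with involvement a x
... | uninvolved e rewrite flipEntry-uninvolved false a s t x e = refl
... | is-a refl    rewrite flipEntry-a a s t =
  trans (slot-≡ᵇ-other a s t v≢a v≢a+1) (sym (≢⇒≡ᵇ-false (v≢a ∘ sym)))
... | is-a+1 refl  rewrite flipEntry-a+1 a s t =
  trans (slot-≡ᵇ-other a s t v≢a v≢a+1) (sym (≢⇒≡ᵇ-false (v≢a+1 ∘ sym)))

count-flipFrom-other : ∀ P a s t r {v} → v ≢ a → v ≢ suc a → count v (flipFrom P a s t r) ≡ count v r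
count-flipFrom-other P a s t []       _ _ = refl
count-flipFrom-other P a s t (x ∷ xs) {v} v≢a v≢a+1
  rewrite count-∷ v (flipEntry (P 0) a s t x) (flipFrom (P ∘ suc) a s (advance (P 0) a t x) xs)
        | count-∷ v x xs | flipEntry-≡ᵇ-other (P 0) a s t x v≢a v≢a+1 =
  cong (𝟙 (x ≡ᵇ v) +_) (count-flipFrom-other (P ∘ suc) a s _ xs v≢a v≢a+1)

𝟙-involved : ∀ a y → 𝟙 (y ≡ᵇ a) + 𝟙 (y ≡ᵇ suc a) ≡ 𝟙 (involved a y)
𝟙-involved a y with involvement a y
... | is-a refl    rewrite ≡ᵇ-refl a | n≡ᵇ1+n a = refl
... | is-a+1 refl  rewrite ≡ᵇ-refl a | 1+n≡ᵇn a = refl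
... | uninvolved e rewrite e = cong₂ (λ b c → 𝟙 b + 𝟙 c) (≢⇒≡ᵇ-false (proj₁ (uninvolved⇒≢ {a} {y} e)))
                                                          (≢⇒≡ᵇ-false (proj₂ (uninvolved⇒≢ {a} {y} e)))

count-a+a+1-∷ : ∀ a x xs → count a (x ∷ xs) + count (suc a) (x ∷ xs) ≡ 𝟙 (involved a x) + (count a xs + count (suc a) xs)
count-a+a+1-∷ a x xs rewrite count-∷ a x xs | count-∷ (suc a) x xs =
  trans (interchange (𝟙 (x ≡ᵇ a)) _ _ _) (cong (_+ _) (𝟙-involved a x))

count-a+a+1-flipFrom : ∀ P a s t r → count a (flipFrom P a s t r) + count (suc a) (flipFrom P a s t r) ≡ count a r + count (suc a) r
count-a+a+1-flipFrom P a s t []       = refl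
count-a+a+1-flipFrom P a s t (x ∷ xs)
  rewrite count-a+a+1-∷ a (flipEntry (P 0) a s t x) (flipFrom (P ∘ suc) a s (advance (P 0) a t x) xs)
        | count-a+a+1-∷ a x xs | involved-flipEntry (P 0) a s t x =
  cong (𝟙 (involved a x) +_) (count-a+a+1-flipFrom (P ∘ suc) a s _ xs)

count-a-split : ∀ P a r → count a r ≡ #paired-a P a r + #free-a P a r
count-a-split P a []       = refl
count-a-split P a (x ∷ xs) rewrite count-∷ a x xs with P 0
... | true rewrite ∧-identityʳ (x ≡ᵇ a) =
  trans (cong (𝟙 (x ≡ᵇ a) +_) (count-a-split (P ∘ suc) a xs)) (sym (+-assoc (𝟙 (x ≡ᵇ a)) _ _))
... | false rewrite ∧-zeroʳ (x ≡ᵇ a) with involvement a x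
...   | uninvolved e rewrite e | ≢⇒≡ᵇ-false (proj₁ (uninvolved⇒≢ {a} {x} e)) = count-a-split (P ∘ suc) a xs
...   | is-a refl    rewrite involved-a a   | ≡ᵇ-refl a =
  trans (cong suc (count-a-split (P ∘ suc) a xs)) (sym (+-suc _ _))
...   | is-a+1 refl  rewrite involved-a+1 a | 1+n≡ᵇn a = count-a-split (P ∘ suc) a xs

count-a+1-flipFrom : ∀ P a s t r → count (suc a) (flipFrom P a s t r) ≡ #paired-a+1 P a r + (#free P a r ∸ (s ∸ t))
count-a+1-flipFrom P a s t []       = sym (0∸n≡0 (s ∸ t))
count-a+1-flipFrom P a s t (x ∷ xs)
  rewrite count-∷ (suc a) (flipEntry (P 0) a s t x) (flipFrom (P ∘ suc) a s (advance (P 0) a t x) xs) with P 0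
... | true rewrite ∧-identityʳ (x ≡ᵇ suc a) =
  trans (cong (𝟙 (x ≡ᵇ suc a) +_) (count-a+1-flipFrom (P ∘ suc) a s t xs)) (sym (+-assoc (𝟙 (x ≡ᵇ suc a)) _ _))
... | false rewrite ∧-zeroʳ (x ≡ᵇ suc a) with involved a x in e
...   | false rewrite ≢⇒≡ᵇ-false (proj₂ (uninvolved⇒≢ {a} {x} e)) = count-a+1-flipFrom (P ∘ suc) a s t xs
...   | true =
  trans (cong (_ +_) (count-a+1-flipFrom (P ∘ suc) a s (suc t) xs))
        (trans (+-exchange (𝟙 (slot a s t ≡ᵇ suc a)) (#paired-a+1 (P ∘ suc) a xs) _)
               (cong (#paired-a+1 (P ∘ suc) a xs +_) (𝟙-slot-a+1 a s t)))

count-a+1-flipRow : ∀ P a r → count (suc a) (flipRow P a r) ≡ #paired-a+1 P a r + #free-a P a r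
count-a+1-flipRow P a r = trans (count-a+1-flipFrom P a s 0 r)
  (cong (#paired-a+1 P a r +_) (trans (cong (_∸ s) (#free-split P a r)) (m+n∸n≡m _ s)))
  where s = #free-a+1 P a r

SemiStandard : Filling → Set
SemiStandard X = Linked (λ m n → n ≤ m) (map length X)
               × All (Linked _≤_) X
               × (∀ i j x y → entry X i j ≡ just x → entry X (suc i) j ≡ just y → x < y)

module _ {X : Filling} (ssX : SemiStandard X) where

  private
    colStrict = proj₂ (proj₂ ssX)

    shorter-below : ∀ i {r₁ r₂} → nth X i ≡ just r₁ → nth X (suc i) ≡ just r₂ → length r₂ ≤ length r₁
    shorter-below i e₁ e₂ = Linked-nth i (proj₁ ssX) (nth-map-just length X i e₁) (nth-map-just length X (suc i) e₂)

  entry-above : ∀ i j {y} → entry X (suc i) j ≡ just y → ∃[ x ] entry X i j ≡ just x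
  entry-above i j e with entry-row X (suc i) j e
  ... | r₂ , e₂ , e₃ with nth-just-≤ X (n≤1+n i) e₂
  ... | r₁ , e₁ with <⇒nth-just r₁ j (≤-trans (nth-just⇒< r₂ j e₃) (shorter-below i e₁ e₂))
  ... | x , e₄ = x , trans (entry-just X i j e₁) e₄

  column-< : ∀ {i k} j {x y} → i < k → entry X i j ≡ just x → entry X k j ≡ just y → x < y
  column-< {i} {suc k} j i<k ex ey with m<1+n⇒m<n∨m≡n i<k
  ... | inj₂ refl = colStrict i j _ _ ex ey
  ... | inj₁ i<k′ with entry-above k j ey
  ...   | z , ez = <-trans (column-< j i<k′ ex ez) (colStrict k j _ _ ez ey)

  column-≤ : ∀ {i k} j {x y} → i ≤ k → entry X i j ≡ just x → entry X k j ≡ just y → x ≤ y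
  column-≤ j i≤k ex ey with m≤n⇒m<n∨m≡n i≤k
  ... | inj₁ i<k = <⇒≤ (column-< j i<k ex ey)
  ... | inj₂ refl with refl ← trans (sym ex) ey = ≤-refl

  column-injective : ∀ {i k} j {v} → entry X i j ≡ just v → entry X k j ≡ just v → i ≡ k
  column-injective {i} {k} j e₁ e₂ with <-cmp i k
  ... | tri< i<k _ _ = contradiction (column-< j i<k e₁ e₂) (n≮n _)
  ... | tri≈ _ i≡k _ = i≡k
  ... | tri> _ _ k<i = contradiction (column-< j k<i e₂ e₁) (n≮n _)

  entry-above* : ∀ {i k} j {y} → i ≤ k → entry X k j ≡ just y → ∃[ x ] entry X i j ≡ just x
  entry-above* {k = k} j i≤k e with m≤n⇒m<n∨m≡n i≤k
  ... | inj₂ refl = _ , e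
  entry-above* {k = suc k} j i≤k e | inj₁ i<k with entry-above k j e
  ... | z , ez = entry-above* j (≤-pred i<k) ez

colHas-complete : ∀ X i j {v} → entry X i j ≡ just v → colHas X j v ≡ true
colHas-complete (r ∷ X) zero    j {v} e rewrite e | ≡ᵇ-refl v = refl
colHas-complete (r ∷ X) (suc i) j     e rewrite colHas-complete X i j e = ∨-zeroʳ _

colHas-sound : ∀ X j v → colHas X j v ≡ true → ∃[ i ] entry X i j ≡ just v
colHas-sound (r ∷ X) j v e with nth r j in er
... | nothing = let (i , p) = colHas-sound X j v e in suc i , p
... | just x with x ≡ᵇ v in ex
...   | true  = zero , trans er (cong just (≡ᵇ-sound ex))
...   | false = let (i , p) = colHas-sound X j v e in suc i , p

pairedAt : Filling → ℕ → ℕ → Bool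
pairedAt X a j = colHas X j a ∧ colHas X j (suc a)

⇒pairedAt : ∀ X a i j → entry X i j ≡ just a → entry X (suc i) j ≡ just (suc a) → pairedAt X a j ≡ true
⇒pairedAt X a i j e₁ e₂ rewrite colHas-complete X i j e₁ | colHas-complete X (suc i) j e₂ = refl

pairedAt⇒ : ∀ {X} → SemiStandard X → ∀ a j → pairedAt X a j ≡ true →
            ∃[ i ] entry X i j ≡ just a × entry X (suc i) j ≡ just (suc a)
pairedAt⇒ {X} ssX a j e with ∧-true {colHas X j a} e
... | ea , ea+1 with colHas-sound X j a ea | colHas-sound X j (suc a) ea+1
... | i₁ , p₁ | i₂ , p₂ with <-cmp i₁ i₂
... | tri> _ _ i₂<i₁ = contradiction (<⇒≤ (column-< ssX j i₂<i₁ p₂ p₁)) 1+n≰n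
... | tri≈ _ refl _ with () ← trans (sym p₁) p₂
... | tri< i₁<i₂ _ _ with entry-above* ssX j i₁<i₂ p₂
... | z , pz = i₁ , p₁ , trans pz (cong just (≤-antisym (column-≤ ssX j i₁<i₂ pz p₂) (proj₂ (proj₂ ssX) i₁ j a z p₁ pz)))

entry-≥ : ∀ {X} → SemiStandard X → All (All (1 ≤_)) X → ∀ i j {x} → entry X i j ≡ just x → suc i ≤ x
entry-≥ {X} ssX pos zero j e with entry-row X zero j e
... | r , er , ex = All-nth j (All-nth zero pos er) ex
entry-≥ {X} ssX pos (suc i) j e with entry-above ssX i j e
... | z , ez = ≤-trans (s≤s (entry-≥ ssX pos i j ez)) (proj₂ (proj₂ ssX) i j z _ ez e)

-- Bender–Knuth as row flipping

unpaired≡free : ∀ X a j x → colHas X j x ≡ true → unpaired X a j x ≡ free (pairedAt X a j) a x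
unpaired≡free X a j x has-x with involvement a x
... | is-a refl rewrite ≡ᵇ-refl a | n≡ᵇ1+n a | has-x with colHas X j (suc a)
...   | true  = refl
...   | false rewrite involved-a a = refl
unpaired≡free X a j x has-x | is-a+1 refl rewrite 1+n≡ᵇn a | ≡ᵇ-refl a | has-x with colHas X j a
...   | true  = refl
...   | false rewrite involved-a+1 a = refl
unpaired≡free X a j x has-x | uninvolved e
  rewrite ≢⇒≡ᵇ-false (proj₁ (uninvolved⇒≢ {a} {x} e)) | ≢⇒≡ᵇ-false (proj₂ (uninvolved⇒≢ {a} {x} e)) with pairedAt X a j
... | true  = refl
... | false = sym e

InColumns : Filling → ℕ → List ℕ → Set
InColumns X j r = ∀ k {x} → nth r k ≡ just x → colHas X (k + j) x ≡ true

InColumns-tail : ∀ {X j x xs} → InColumns X j (x ∷ xs) → InColumns X (suc j) xs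
InColumns-tail {j = j} h k e rewrite +-suc k j = h (suc k) e

rewriteRow≡flipFrom : ∀ X a s j t r → InColumns X j r →
                      rewriteRow X a s j t r ≡ flipFrom (λ k → pairedAt X a (k + j)) a s t r
rewriteRow≡flipFrom X a s j t []       h = refl
rewriteRow≡flipFrom X a s j t (x ∷ xs) h rewrite unpaired≡free X a j x (h 0 refl) with free (pairedAt X a j) a x
... | true  = cong (_ ∷_) (trans (rewriteRow≡flipFrom X a s (suc j) (suc t) xs (InColumns-tail {X} {j} h))
                                 (flipFrom-cong a s (suc t) xs (λ k → cong (pairedAt X a) (+-suc k j))))
... | false = cong (_ ∷_) (trans (rewriteRow≡flipFrom X a s (suc j) t xs (InColumns-tail {X} {j} h))
                                 (flipFrom-cong a s t xs (λ k → cong (pairedAt X a) (+-suc k j))))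

countUnp≡#free-a+1 : ∀ X a j r → InColumns X j r →
                     countUnp X a (suc a) j r ≡ #free-a+1 (λ k → pairedAt X a (k + j)) a r
countUnp≡#free-a+1 X a j []       h = refl
countUnp≡#free-a+1 X a j (x ∷ xs) h rewrite unpaired≡free X a j x (h 0 refl) =
  cong (_ +_) (trans (countUnp≡#free-a+1 X a (suc j) xs (InColumns-tail {X} {j} h))
                     (countAt-cong xs (λ k {y} _ → cong (λ i → free (pairedAt X a i) a y ∧ (y ≡ᵇ suc a)) (+-suc k j))))

bkRow≡flipRow : ∀ X a r → InColumns X 0 r → bkRow X a r ≡ flipRow (pairedAt X a) a r
bkRow≡flipRow X a r h = begin
  rewriteRow X a (countUnp X a (suc a) 0 r) 0 0 r              ≡⟨ cong (λ c → rewriteRow X a c 0 0 r) (countUnp≡#free-a+1 X a 0 r h) ⟩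
  rewriteRow X a (#free-a+1 (λ k → pairedAt X a (k + 0)) a r) 0 0 r ≡⟨ rewriteRow≡flipFrom X a _ 0 0 r h ⟩
  flipRow (λ k → pairedAt X a (k + 0)) a r                     ≡⟨ flipRow-cong a r (λ k → cong (pairedAt X a) (+-identityʳ k)) ⟩
  flipRow (pairedAt X a) a r                                   ∎
  where open ≡-Reasoning

flipRows : ℕ → Filling → Filling
flipRows a X = map (flipRow (pairedAt X a) a) X

BK≡flipRows : ∀ a X → BK a X ≡ flipRows a X
BK≡flipRows a X = map-cong-nth X λ i e → bkRow≡flipRow X a _ (in-columns i e)
  where
  in-columns : ∀ i {r} → nth X i ≡ just r → InColumns X 0 r
  in-columns i e k ex rewrite +-identityʳ k = colHas-complete X i k (trans (entry-just X i k e) ex)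

entry-flipRows : ∀ a X i j {x} → entry X i j ≡ just x →
                 ∃[ s ] ∃[ t ] entry (flipRows a X) i j ≡ just (flipEntry (pairedAt X a j) a s t x)
entry-flipRows a X i j e with entry-row X i j e
... | r , er , ex with nth-flipFrom (pairedAt X a) a (#free-a+1 (pairedAt X a) a r) 0 r j ex
... | t , et = #free-a+1 (pairedAt X a) a r , t , trans (entry-just (flipRows a X) i j (nth-map-just _ X i er)) et

entry-flipRows⁻ : ∀ a X i j {y} → entry (flipRows a X) i j ≡ just y →
                  ∃[ x ] ∃[ s ] ∃[ t ] entry X i j ≡ just x × y ≡ flipEntry (pairedAt X a j) a s t x
entry-flipRows⁻ a X i j e with entry-row (flipRows a X) i j e
... | r′ , er′ , ey with nth-map-just⁻ (flipRow (pairedAt X a) a) X i er′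
... | r , er , refl with nth-flipFrom⁻ (pairedAt X a) a (#free-a+1 (pairedAt X a) a r) 0 r j ey
... | x , ex , t , refl = x , #free-a+1 (pairedAt X a) a r , t , trans (entry-just X i j er) ex , refl

pairedAt-flipRows : ∀ {X} → SemiStandard X → ∀ a j → pairedAt (flipRows a X) a j ≡ pairedAt X a j
pairedAt-flipRows {X} ssX a j = ⇔→≡ (mk⇔ to from)
  where
  from : pairedAt X a j ≡ true → pairedAt (flipRows a X) a j ≡ true
  from p with pairedAt⇒ ssX a j p
  ... | i , e₁ , e₂ with entry-flipRows a X i j e₁ | entry-flipRows a X (suc i) j e₂
  ... | _ , _ , f₁ | _ , _ , f₂ rewrite p = ⇒pairedAt (flipRows a X) a i j f₁ f₂

  involved-before : ∀ {s t x v} → v ≡ flipEntry false a s t x → involved a v ≡ true → involved a x ≡ true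
  involved-before {s} {t} {x} refl iv = trans (sym (involved-flipEntry false a s t x)) iv

  to : pairedAt (flipRows a X) a j ≡ true → pairedAt X a j ≡ true
  to p with ∧-true {colHas (flipRows a X) j a} p
  ... | has-a , has-a+1 with colHas-sound (flipRows a X) j a has-a | colHas-sound (flipRows a X) j (suc a) has-a+1
  ... | i₁ , p₁ | i₂ , p₂ with entry-flipRows⁻ a X i₁ j p₁ | entry-flipRows⁻ a X i₂ j p₂
  ... | x₁ , s₁ , t₁ , q₁ , h₁ | x₂ , s₂ , t₂ , q₂ , h₂ with pairedAt X a j in unpaired
  ... | true  = refl
  ... | false with involvement a x₁ | involvement a x₂
  ... | uninvolved e₁ | _ with () ← trans (sym (involved-before {s₁} {t₁} {x₁} h₁ (involved-a a))) e₁
  ... | _ | uninvolved e₂ with () ← trans (sym (involved-before {s₂} {t₂} {x₂} h₂ (involved-a+1 a))) e₂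
  ... | is-a refl   | is-a refl   with refl ← column-injective ssX j q₁ q₂ with () ← trans (sym p₁) p₂
  ... | is-a+1 refl | is-a+1 refl with refl ← column-injective ssX j q₁ q₂ with () ← trans (sym p₁) p₂
  ... | is-a refl   | is-a+1 refl = trans (sym unpaired) (cong₂ _∧_ (colHas-complete X i₁ j q₁) (colHas-complete X i₂ j q₂))
  ... | is-a+1 refl | is-a refl   = trans (sym unpaired) (cong₂ _∧_ (colHas-complete X i₂ j q₂) (colHas-complete X i₁ j q₁))

flipRows-involutive : ∀ {X} → SemiStandard X → ∀ a → flipRows a (flipRows a X) ≡ X
flipRows-involutive {X} ssX a = begin
  map (flipRow (pairedAt (flipRows a X) a) a) (flipRows a X)
    ≡⟨ map-cong-nth (flipRows a X) (λ _ _ → flipRow-cong a _ (pairedAt-flipRows ssX a)) ⟩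
  map (flipRow P a) (map (flipRow P a) X)
    ≡⟨ sym (map-∘ X) ⟩
  map (flipRow P a ∘ flipRow P a) X
    ≡⟨ map-cong-nth X (λ i e → flipRow-involutive P a _ (All-nth i (proj₁ (proj₂ ssX)) e)) ⟩
  map id X
    ≡⟨ map-id X ⟩
  X ∎
  where
  open ≡-Reasoning
  P = pairedAt X a

map-length-flipRows : ∀ a X → map length (flipRows a X) ≡ map length X
map-length-flipRows a X =
  trans (sym (map-∘ X)) (map-cong-nth X (λ _ {r} _ → length-flipFrom (pairedAt X a) a (#free-a+1 (pairedAt X a) a r) 0 r))

module _ {X : Filling} (ssX : SemiStandard X) (a : ℕ) where

  private
    colStrict = proj₂ (proj₂ ssX)

  paired-a-leftwards : ∀ i k → entry X i k ≡ just a → entry X i (suc k) ≡ just a →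
                       pairedAt X a (suc k) ≡ true → pairedAt X a k ≡ true
  paired-a-leftwards i k e₁ e₂ p with pairedAt⇒ ssX a (suc k) p
  ... | i′ , f₁ , f₂ with refl ← column-injective ssX (suc k) e₂ f₁ with entry-row X (suc i) (suc k) f₂
  ... | r , er , ez with nth-just-≤ r (n≤1+n k) ez
  ... | z , ez′ = ⇒pairedAt X a i k e₁ (trans below (cong just z≡a+1))
    where
    below : entry X (suc i) k ≡ just z
    below = trans (entry-just X (suc i) k er) ez′
    z≡a+1 : z ≡ suc a
    z≡a+1 = ≤-antisym (Linked-nth k (All-nth (suc i) (proj₁ (proj₂ ssX)) er) ez′ ez) (colStrict i k a z e₁ below)

  paired-a+1-rightwards : ∀ i k → entry X i k ≡ just (suc a) → entry X i (suc k) ≡ just (suc a) →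
                          pairedAt X a k ≡ true → pairedAt X a (suc k) ≡ true
  paired-a+1-rightwards i k e₁ e₂ p with pairedAt⇒ ssX a k p
  ... | i′ , f₁ , f₂ with refl ← column-injective ssX k f₂ e₁ with entry-above ssX i′ (suc k) e₂
  ... | w , ew with entry-row X i′ (suc k) ew
  ... | r , er , ew′ = ⇒pairedAt X a i′ (suc k) (trans ew (cong just w≡a)) e₂
    where
    w≡a : w ≡ a
    w≡a = ≤-antisym (≤-pred (colStrict i′ (suc k) w (suc a) ew e₂))
                    (Linked-nth k (All-nth i′ (proj₁ (proj₂ ssX)) er) (trans (sym (entry-just X i′ k er)) f₁) ew′)

  pairedAtEnds : ∀ i {r} → nth X i ≡ just r → PairedAtEnds (pairedAt X a) a r
  pairedAtEnds i er k ex ey =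
    (λ { refl refl → paired-a-leftwards i k (at ex) (at ey) }) ,
    (λ { refl refl → paired-a+1-rightwards i k (at ex) (at ey) })
    where
    at : ∀ {j v} → _ ≡ just v → entry X i j ≡ just v
    at {j} e = trans (entry-just X i j er) e

  flipRows-rows-sorted : All (Linked _≤_) (flipRows a X)
  flipRows-rows-sorted = nth⇒All (flipRows a X) λ i e → case nth-map-just⁻ (flipRow (pairedAt X a) a) X i e of λ
    { (r , er , refl) → flipFrom-sorted _ a _ 0 r (All-nth i (proj₁ (proj₂ ssX)) er) (pairedAtEnds i er) }

  flipRows-columns : ∀ i j x′ y′ → entry (flipRows a X) i j ≡ just x′ → entry (flipRows a X) (suc i) j ≡ just y′ → x′ < y′
  flipRows-columns i j x′ y′ ex′ ey′ with entry-flipRows⁻ a X i j ex′ | entry-flipRows⁻ a X (suc i) j ey′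
  ... | x , s₁ , t₁ , ex , refl | y , s₂ , t₂ , ey , refl with colStrict i j x y ex ey | pairedAt X a j in paired
  ... | x<y | true = x<y
  ... | x<y | false with involvement a x | involvement a y
  ... | uninvolved e₁ | uninvolved e₂
    rewrite flipEntry-uninvolved false a s₁ t₁ x e₁ | flipEntry-uninvolved false a s₂ t₂ y e₂ = x<y
  ... | uninvolved e₁ | is-a refl rewrite flipEntry-uninvolved false a s₁ t₁ x e₁ | flipEntry-a a s₂ t₂ =
    <-≤-trans (uninvolved≤a+1⇒<a e₁ (≤-trans (<⇒≤ x<y) (n≤1+n a))) (a≤slot a s₂ t₂)
  ... | uninvolved e₁ | is-a+1 refl rewrite flipEntry-uninvolved false a s₁ t₁ x e₁ | flipEntry-a+1 a s₂ t₂ =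
    <-≤-trans (uninvolved≤a+1⇒<a e₁ (<⇒≤ x<y)) (a≤slot a s₂ t₂)
  ... | is-a refl | uninvolved e₂ rewrite flipEntry-uninvolved false a s₂ t₂ y e₂ | flipEntry-a a s₁ t₁ =
    <-≤-trans (s≤s (slot≤a+1 a s₁ t₁)) (uninvolved≥a⇒>a+1 e₂ (<⇒≤ x<y))
  ... | is-a+1 refl | uninvolved e₂ rewrite flipEntry-uninvolved false a s₂ t₂ y e₂ | flipEntry-a+1 a s₁ t₁ =
    <-≤-trans (s≤s (slot≤a+1 a s₁ t₁)) (uninvolved≥a⇒>a+1 e₂ (≤-trans (n≤1+n a) (<⇒≤ x<y)))
  ... | is-a refl   | is-a refl   = contradiction x<y (n≮n a)
  ... | is-a+1 refl | is-a refl   = contradiction (<-trans (n<1+n a) x<y) (n≮n a)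
  ... | is-a+1 refl | is-a+1 refl = contradiction x<y (n≮n (suc a))
  ... | is-a refl   | is-a+1 refl with () ← trans (sym paired) (⇒pairedAt X a i j ex ey)

  flipRows-SemiStandard : SemiStandard (flipRows a X)
  flipRows-SemiStandard = subst (Linked _) (sym (map-length-flipRows a X)) (proj₁ ssX) , flipRows-rows-sorted , flipRows-columns

flipRows-pos : ∀ a X → 1 ≤ a → All (All (1 ≤_)) X → All (All (1 ≤_)) (flipRows a X)
flipRows-pos a X 1≤a pos = nth⇒All (flipRows a X) λ i e → case nth-map-just⁻ (flipRow (pairedAt X a) a) X i e of λ
  { (r , er , refl) → flipFrom-pos _ a _ 0 r 1≤a (All-nth i pos er) }

hasAt : ℕ → List ℕ → ℕ → Bool
hasAt v r k = maybe (_≡ᵇ v) false (nth r k)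

#pairs : ℕ → List ℕ → List ℕ → ℕ
#pairs a r r′ = countAt (λ k x → (x ≡ᵇ a) ∧ hasAt (suc a) r′ k) r

countAt-false : ∀ f r → (∀ k x → f k x ≡ false) → countAt f r ≡ 0
countAt-false f []       h = refl
countAt-false f (x ∷ xs) h rewrite h 0 x = countAt-false (f ∘ suc) xs (h ∘ suc)

#pairs-[] : ∀ a r → #pairs a r [] ≡ 0
#pairs-[] a r = countAt-false _ r (λ k x → ∧-zeroʳ (x ≡ᵇ a))

#pairs-by-lower-row : ∀ a r r′ → #pairs a r r′ ≡ countAt (λ k y → (y ≡ᵇ suc a) ∧ hasAt a r k) r′
#pairs-by-lower-row a []       r′       = sym (countAt-false _ r′ (λ k y → ∧-zeroʳ (y ≡ᵇ suc a)))
#pairs-by-lower-row a (x ∷ xs) []       = #pairs-[] a (x ∷ xs)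
#pairs-by-lower-row a (x ∷ xs) (y ∷ ys) rewrite ∧-comm (x ≡ᵇ a) (y ≡ᵇ suc a) = cong (_ +_) (#pairs-by-lower-row a xs ys)

hasAt-complete : ∀ v X m k → entry X m k ≡ just v → hasAt v (rowAt X (suc m)) k ≡ true
hasAt-complete v X m k e with entry-row X m k e
... | r , er , ek rewrite er | ek = ≡ᵇ-refl v

hasAt-sound : ∀ v X m k → hasAt v (rowAt X m) k ≡ true → ∃[ m′ ] m ≡ suc m′ × entry X m′ k ≡ just v
hasAt-sound v X (suc m) k e with nth X m in er
... | just r with nth r k in ek
...   | just y = m , refl , trans (entry-just X m k er) (trans ek (cong just (≡ᵇ-sound e)))

pairsBelow : ℕ → Filling → ℕ
pairsBelow a []       = 0
pairsBelow a (r ∷ rs) = #pairs a r (rowAt rs 1) + pairsBelow a rs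

pairsAbove : ℕ → List ℕ → Filling → ℕ
pairsAbove a p []       = 0
pairsAbove a p (r ∷ rs) = #pairs a p r + pairsAbove a r rs

pairsBelow≡pairsAbove : ∀ a p rs → #pairs a p (rowAt rs 1) + pairsBelow a rs ≡ pairsAbove a p rs
pairsBelow≡pairsAbove a p []       = cong (_+ 0) (#pairs-[] a p)
pairsBelow≡pairsAbove a p (r ∷ rs) = cong (#pairs a p r +_) (pairsBelow≡pairsAbove a r rs)

Suffix : Filling → ℕ → Filling → Set
Suffix X i rs = ∀ k → nth rs k ≡ nth X (k + i)

Suffix-tail : ∀ {X i r rs} → Suffix X i (r ∷ rs) → Suffix X (suc i) rs
Suffix-tail {i = i} h k rewrite +-suc k i = h (suc k)

module _ {X : Filling} (ssX : SemiStandard X) (a : ℕ) where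

  #paired-a-row : ∀ i {r} → nth X i ≡ just r → #paired-a (pairedAt X a) a r ≡ #pairs a r (rowAt X (suc (suc i)))
  #paired-a-row i {r} er = countAt-cong r same
    where
    same : ∀ k {x} → nth r k ≡ just x → ((x ≡ᵇ a) ∧ pairedAt X a k) ≡ ((x ≡ᵇ a) ∧ hasAt (suc a) (rowAt X (suc (suc i))) k)
    same k {x} ex with x ≡ᵇ a in x≡a
    ... | false = refl
    ... | true  = ⇔→≡ (mk⇔ to from)
      where
      at : entry X i k ≡ just a
      at = trans (entry-just X i k er) (trans ex (cong just (≡ᵇ-sound x≡a)))
      to : pairedAt X a k ≡ true → hasAt (suc a) (rowAt X (suc (suc i))) k ≡ true
      to p with pairedAt⇒ ssX a k p
      ... | i′ , e₁ , e₂ with refl ← column-injective ssX k at e₁ = hasAt-complete (suc a) X (suc i) k e₂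
      from : hasAt (suc a) (rowAt X (suc (suc i))) k ≡ true → pairedAt X a k ≡ true
      from h with hasAt-sound (suc a) X (suc (suc i)) k h
      ... | _ , refl , below = ⇒pairedAt X a i k at below

  #paired-a+1-row : ∀ i {r} → nth X i ≡ just r → #paired-a+1 (pairedAt X a) a r ≡ #pairs a (rowAt X i) r
  #paired-a+1-row i {r} er = trans (countAt-cong r same) (sym (#pairs-by-lower-row a (rowAt X i) r))
    where
    same : ∀ k {y} → nth r k ≡ just y → ((y ≡ᵇ suc a) ∧ pairedAt X a k) ≡ ((y ≡ᵇ suc a) ∧ hasAt a (rowAt X i) k)
    same k {y} ey with y ≡ᵇ suc a in y≡a+1
    ... | false = refl
    ... | true  = ⇔→≡ (mk⇔ to from)
      where
      at : entry X i k ≡ just (suc a)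
      at = trans (entry-just X i k er) (trans ey (cong just (≡ᵇ-sound y≡a+1)))
      to : pairedAt X a k ≡ true → hasAt a (rowAt X i) k ≡ true
      to p with pairedAt⇒ ssX a k p
      ... | i′ , e₁ , e₂ with refl ← column-injective ssX k e₂ at = hasAt-complete a X i′ k e₁
      from : hasAt a (rowAt X i) k ≡ true → pairedAt X a k ≡ true
      from h with hasAt-sound a X i k h
      ... | i′ , refl , above = ⇒pairedAt X a i′ k above at

  sum-#paired-a : ∀ i rs → Suffix X i rs → sum (map (#paired-a (pairedAt X a) a) rs) ≡ pairsBelow a rs
  sum-#paired-a i []       h = refl
  sum-#paired-a i (r ∷ rs) h =
    cong₂ _+_ (trans (#paired-a-row i (sym (h 0))) (cong (#pairs a r ∘ maybe id []) (sym (h 1))))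
              (sum-#paired-a (suc i) rs (Suffix-tail {X} {i} h))

  sum-#paired-a+1 : ∀ i rs → Suffix X i rs → sum (map (#paired-a+1 (pairedAt X a) a) rs) ≡ pairsAbove a (rowAt X i) rs
  sum-#paired-a+1 i []       h = refl
  sum-#paired-a+1 i (r ∷ rs) h =
    cong₂ _+_ (#paired-a+1-row i (sym (h 0)))
              (trans (sum-#paired-a+1 (suc i) rs (Suffix-tail {X} {i} h)) (cong (λ p → pairsAbove a (maybe id [] p) rs) (sym (h 0))))

  -- paired a's and paired (a+1)'s match up column by column, one row apart
  sum-#paired-a+1≡sum-#paired-a : sum (map (#paired-a+1 (pairedAt X a) a) X) ≡ sum (map (#paired-a (pairedAt X a) a) X)
  sum-#paired-a+1≡sum-#paired-a = begin
    sum (map (#paired-a+1 (pairedAt X a) a) X) ≡⟨ sum-#paired-a+1 0 X whole ⟩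
    pairsAbove a [] X                           ≡⟨ sym (pairsBelow≡pairsAbove a [] X) ⟩
    pairsBelow a X                              ≡⟨ sym (sum-#paired-a 0 X whole) ⟩
    sum (map (#paired-a (pairedAt X a) a) X)   ∎
    where
    open ≡-Reasoning
    whole : Suffix X 0 X
    whole k = cong (nth X) (sym (+-identityʳ k))

sum-map-∘ : ∀ {A B : Set} (f : B → ℕ) (g : A → B) xs → sum (map f (map g xs)) ≡ sum (map (f ∘ g) xs)
sum-map-∘ f g xs = cong sum (sym (map-∘ xs))

content-flipRows-other : ∀ a X {v} → v ≢ a → v ≢ suc a → contentOf (flipRows a X) v ≡ contentOf X v
content-flipRows-other a X v≢a v≢a+1 =
  trans (sum-map-∘ _ _ X) (sum-map-cong X (λ r → count-flipFrom-other (pairedAt X a) a _ 0 r v≢a v≢a+1))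

content-flipRows-a+1 : ∀ {X} → SemiStandard X → ∀ a → contentOf (flipRows a X) (suc a) ≡ contentOf X a
content-flipRows-a+1 {X} ssX a = begin
  contentOf (flipRows a X) (suc a)                        ≡⟨ sum-map-∘ _ _ X ⟩
  sum (map (count (suc a) ∘ flipRow P a) X)               ≡⟨ sum-map-cong X (count-a+1-flipRow P a) ⟩
  sum (map (λ r → #paired-a+1 P a r + #free-a P a r) X)   ≡⟨ sum-map-+ _ _ X ⟩
  sum (map (#paired-a+1 P a) X) + sum (map (#free-a P a) X) ≡⟨ cong (_+ sum (map (#free-a P a) X)) (sum-#paired-a+1≡sum-#paired-a ssX a) ⟩
  sum (map (#paired-a P a) X) + sum (map (#free-a P a) X)   ≡⟨ sym (sum-map-+ _ _ X) ⟩
  sum (map (λ r → #paired-a P a r + #free-a P a r) X)     ≡⟨ sym (sum-map-cong X (count-a-split P a)) ⟩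
  contentOf X a                                           ∎
  where
  open ≡-Reasoning
  P = pairedAt X a

content-flipRows-a : ∀ {X} → SemiStandard X → ∀ a → contentOf (flipRows a X) a ≡ contentOf X (suc a)
content-flipRows-a {X} ssX a = +-cancelʳ-≡ (contentOf (flipRows a X) (suc a)) _ _ (begin
  contentOf (flipRows a X) a + contentOf (flipRows a X) (suc a)
    ≡⟨ sym (sum-map-+ _ _ (flipRows a X)) ⟩
  sum (map (λ r → count a r + count (suc a) r) (flipRows a X))
    ≡⟨ sum-map-∘ _ _ X ⟩
  sum (map (λ r → count a (flipRow P a r) + count (suc a) (flipRow P a r)) X)
    ≡⟨ sum-map-cong X (λ r → count-a+a+1-flipFrom P a (#free-a+1 P a r) 0 r) ⟩
  sum (map (λ r → count a r + count (suc a) r) X)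
    ≡⟨ sum-map-+ _ _ X ⟩
  contentOf X a + contentOf X (suc a)
    ≡⟨ +-comm (contentOf X a) _ ⟩
  contentOf X (suc a) + contentOf X a
    ≡⟨ cong (contentOf X (suc a) +_) (sym (content-flipRows-a+1 ssX a)) ⟩
  contentOf X (suc a) + contentOf (flipRows a X) (suc a) ∎)
  where
  open ≡-Reasoning
  P = pairedAt X a

-- Lowering the leftmost a+1 of a row

length-replaceLeftmost : ∀ k r → length (replaceLeftmost k r) ≡ length r
length-replaceLeftmost k []       = refl
length-replaceLeftmost k (x ∷ xs) with x ≡ᵇ k
... | true  = refl
... | false = cong suc (length-replaceLeftmost k xs)

nth-replaceLeftmost⁻ : ∀ a r j {y} → nth (replaceLeftmost (suc a) r) j ≡ just y →
                       ∃[ x ] nth r j ≡ just x × (y ≡ x ⊎ (x ≡ suc a × y ≡ a))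
nth-replaceLeftmost⁻ a (x ∷ xs) j e with x ≡ᵇ suc a in ex
nth-replaceLeftmost⁻ a (x ∷ xs) zero    refl | true  = x , refl , inj₂ (≡ᵇ-sound ex , refl)
nth-replaceLeftmost⁻ a (x ∷ xs) (suc j) e    | true  = _ , e , inj₁ refl
nth-replaceLeftmost⁻ a (x ∷ xs) zero    refl | false = x , refl , inj₁ refl
nth-replaceLeftmost⁻ a (x ∷ xs) (suc j) e    | false = nth-replaceLeftmost⁻ a xs j e

nth-replaceLeftmost : ∀ a r j {x} → nth r j ≡ just x →
                      ∃[ y ] nth (replaceLeftmost (suc a) r) j ≡ just y × (y ≡ x ⊎ (x ≡ suc a × y ≡ a))
nth-replaceLeftmost a (x ∷ xs) j e with x ≡ᵇ suc a in ex
nth-replaceLeftmost a (x ∷ xs) zero    refl | true  = a , refl , inj₂ (≡ᵇ-sound ex , refl)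
nth-replaceLeftmost a (x ∷ xs) (suc j) e    | true  = _ , e , inj₁ refl
nth-replaceLeftmost a (x ∷ xs) zero    refl | false = x , refl , inj₁ refl
nth-replaceLeftmost a (x ∷ xs) (suc j) e    | false = nth-replaceLeftmost a xs j e

replaceLeftmost-All : ∀ {P : ℕ → Set} a r → P a → All P r → All P (replaceLeftmost (suc a) r)
replaceLeftmost-All a []       Pa []         = []
replaceLeftmost-All a (x ∷ xs) Pa (Px ∷ Pxs) with x ≡ᵇ suc a
... | true  = Pa ∷ Pxs
... | false = Px ∷ replaceLeftmost-All a xs Pa Pxs

replaceLeftmost-sorted : ∀ a r → Linked _≤_ r → All (_≤ suc a) r → Linked _≤_ (replaceLeftmost (suc a) r)
replaceLeftmost-sorted a []           _         _ = []
replaceLeftmost-sorted a (x ∷ [])     _         _ with x ≡ᵇ suc a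
... | true  = [-]
... | false = [-]
replaceLeftmost-sorted a (x ∷ y ∷ ys) (x≤y ∷ l) (x≤a+1 ∷ bound) with x ≡ᵇ suc a in ex
... | true  = ≤-trans (n≤1+n a) (subst (_≤ y) (≡ᵇ-sound ex) x≤y) ∷ l
... | false with y ≡ᵇ suc a | replaceLeftmost-sorted a (y ∷ ys) l bound
...   | true  | l′ = ≤-pred (≤∧≢⇒< x≤a+1 (≡ᵇ-false⇒≢ ex)) ∷ l′
...   | false | l′ = x≤y ∷ l′

𝟙-a-a+1-swap : ∀ a v → 𝟙 (a ≡ᵇ v) + 𝟙 (v ≡ᵇ suc a) ≡ 𝟙 (suc a ≡ᵇ v) + 𝟙 (v ≡ᵇ a)
𝟙-a-a+1-swap a v with v ≟ a | v ≟ suc a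
... | yes refl | _        rewrite ≡ᵇ-refl v | n≡ᵇ1+n v | 1+n≡ᵇn v = refl
... | no v≢a   | yes refl rewrite ≡ᵇ-refl a | n≡ᵇ1+n a | 1+n≡ᵇn a = refl
... | no v≢a   | no v≢a+1 rewrite ≢⇒≡ᵇ-false (v≢a ∘ sym) | ≢⇒≡ᵇ-false v≢a+1
                                | ≢⇒≡ᵇ-false (v≢a+1 ∘ sym) | ≢⇒≡ᵇ-false v≢a = refl

count-replaceLeftmost : ∀ a r v → Occurs (suc a) r →
                        count v (replaceLeftmost (suc a) r) + 𝟙 (v ≡ᵇ suc a) ≡ count v r + 𝟙 (v ≡ᵇ a)
count-replaceLeftmost a (x ∷ xs) v (j , hj) with x ≡ᵇ suc a in ex
... | true rewrite ≡ᵇ-sound {x} {suc a} ex | count-∷ v a xs | count-∷ v (suc a) xs = begin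
  𝟙 (a ≡ᵇ v) + count v xs + 𝟙 (v ≡ᵇ suc a)     ≡⟨ +-assoc (𝟙 (a ≡ᵇ v)) _ _ ⟩
  𝟙 (a ≡ᵇ v) + (count v xs + 𝟙 (v ≡ᵇ suc a))   ≡⟨ +-exchange (𝟙 (a ≡ᵇ v)) (count v xs) (𝟙 (v ≡ᵇ suc a)) ⟩
  count v xs + (𝟙 (a ≡ᵇ v) + 𝟙 (v ≡ᵇ suc a))   ≡⟨ cong (count v xs +_) (𝟙-a-a+1-swap a v) ⟩
  count v xs + (𝟙 (suc a ≡ᵇ v) + 𝟙 (v ≡ᵇ a))   ≡⟨ +-exchange (count v xs) (𝟙 (suc a ≡ᵇ v)) (𝟙 (v ≡ᵇ a)) ⟩
  𝟙 (suc a ≡ᵇ v) + (count v xs + 𝟙 (v ≡ᵇ a))   ≡⟨ sym (+-assoc (𝟙 (suc a ≡ᵇ v)) _ _) ⟩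
  𝟙 (suc a ≡ᵇ v) + count v xs + 𝟙 (v ≡ᵇ a)     ∎
  where open ≡-Reasoning
count-replaceLeftmost a (x ∷ xs) v (zero , refl) | false rewrite ≡ᵇ-refl a with () ← ex
count-replaceLeftmost a (x ∷ xs) v (suc j , hj) | false
  rewrite count-∷ v x (replaceLeftmost (suc a) xs) | count-∷ v x xs
        | +-assoc (𝟙 (x ≡ᵇ v)) (count v (replaceLeftmost (suc a) xs)) (𝟙 (v ≡ᵇ suc a))
        | +-assoc (𝟙 (x ≡ᵇ v)) (count v xs) (𝟙 (v ≡ᵇ a)) =
  cong (𝟙 (x ≡ᵇ v) +_) (count-replaceLeftmost a xs v (j , hj))

Unpaired-a+1 : (ℕ → Bool) → ℕ → List ℕ → Set
Unpaired-a+1 P a r = ∀ j → nth r j ≡ just (suc a) → P j ≡ false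

Unpaired-a+1-tail : ∀ {P a x xs} → Unpaired-a+1 P a (x ∷ xs) → Unpaired-a+1 (P ∘ suc) a xs
Unpaired-a+1-tail h j = h (suc j)

flipFrom-replaceLeftmost : ∀ P a s t r → Unpaired-a+1 P a r →
                           flipFrom P a s t (replaceLeftmost (suc a) r) ≡ flipFrom P a s t r
flipFrom-replaceLeftmost P a s t []       h = refl
flipFrom-replaceLeftmost P a s t (x ∷ xs) h with x ≡ᵇ suc a in ex
... | true with refl ← ≡ᵇ-sound {x} ex rewrite h 0 refl
             | flipEntry-a a s t | flipEntry-a+1 a s t | advance-a a t | advance-a+1 a t = refl
... | false = cong (flipEntry (P 0) a s t x ∷_) (flipFrom-replaceLeftmost (P ∘ suc) a s _ xs (Unpaired-a+1-tail {P} h))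

#free-a+1-replaceLeftmost : ∀ P a r → Unpaired-a+1 P a r → Occurs (suc a) r →
                            suc (#free-a+1 P a (replaceLeftmost (suc a) r)) ≡ #free-a+1 P a r
#free-a+1-replaceLeftmost P a (x ∷ xs) h (j , hj) with x ≡ᵇ suc a in ex
... | true with refl ← ≡ᵇ-sound {x} ex rewrite h 0 refl | involved-a a | involved-a+1 a | n≡ᵇ1+n a | ≡ᵇ-refl a = refl
#free-a+1-replaceLeftmost P a (x ∷ xs) h (zero  , refl) | false rewrite ≡ᵇ-refl a with () ← ex
#free-a+1-replaceLeftmost P a (x ∷ xs) h (suc j , hj)   | false rewrite ex =
  trans (sym (+-suc _ _)) (cong (_ +_) (#free-a+1-replaceLeftmost (P ∘ suc) a xs (Unpaired-a+1-tail {P} h) (j , hj)))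

#free-a-replaceLeftmost : ∀ P a r → Unpaired-a+1 P a r → Occurs (suc a) r →
                          #free-a P a (replaceLeftmost (suc a) r) ≡ suc (#free-a P a r)
#free-a-replaceLeftmost P a (x ∷ xs) h (j , hj) with x ≡ᵇ suc a in ex
... | true with refl ← ≡ᵇ-sound {x} ex rewrite h 0 refl | involved-a a | involved-a+1 a | 1+n≡ᵇn a | ≡ᵇ-refl a = refl
#free-a-replaceLeftmost P a (x ∷ xs) h (zero  , refl) | false rewrite ≡ᵇ-refl a with () ← ex
#free-a-replaceLeftmost P a (x ∷ xs) h (suc j , hj)   | false =
  trans (cong (_ +_) (#free-a-replaceLeftmost (P ∘ suc) a xs (Unpaired-a+1-tail {P} h) (j , hj))) (+-suc _ _)

t≤advance : ∀ p a t x → t ≤ advance p a t x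
t≤advance p a t x with free p a x
... | true  = n≤1+n t
... | false = ≤-refl

-- once t free positions are passed, any bound s ≤ t writes only a+1's
flipFrom-exhausted : ∀ P a s₁ s₂ t r → s₁ ≤ t → s₂ ≤ t → flipFrom P a s₁ t r ≡ flipFrom P a s₂ t r
flipFrom-exhausted P a s₁ s₂ t []       _ _ = refl
flipFrom-exhausted P a s₁ s₂ t (x ∷ xs) s₁≤t s₂≤t = cong₂ _∷_ same-head
  (flipFrom-exhausted (P ∘ suc) a s₁ s₂ _ xs (≤-trans s₁≤t (t≤advance (P 0) a t x)) (≤-trans s₂≤t (t≤advance (P 0) a t x)))
  where
  same-head : flipEntry (P 0) a s₁ t x ≡ flipEntry (P 0) a s₂ t x
  same-head rewrite ≥⇒<ᵇ-false {t} {s₁} s₁≤t | ≥⇒<ᵇ-false {t} {s₂} s₂≤t = refl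

replaceLeftmost-∷ : ∀ a x xs → (x ≡ᵇ suc a) ≡ false → replaceLeftmost (suc a) (x ∷ xs) ≡ x ∷ replaceLeftmost (suc a) xs
replaceLeftmost-∷ a x xs e rewrite e = refl

replaceLeftmost-flipFrom : ∀ P a s t r → Unpaired-a+1 P a r → t ≤ s → s < t + #free P a r →
                           replaceLeftmost (suc a) (flipFrom P a s t r) ≡ flipFrom P a (suc s) t r
replaceLeftmost-flipFrom P a s t [] h t≤s s<t+0 rewrite +-identityʳ t = contradiction t≤s (<⇒≱ s<t+0)
replaceLeftmost-flipFrom P a s t (x ∷ xs) h t≤s s<t+n with P 0 in p₀
... | true with x ≡ᵇ suc a in ex
...   | true  with () ← trans (sym p₀) (h 0 (cong just (≡ᵇ-sound ex)))
...   | false = cong (x ∷_) (replaceLeftmost-flipFrom (P ∘ suc) a s t xs (Unpaired-a+1-tail {P} h) t≤s s<t+n)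
replaceLeftmost-flipFrom P a s t (x ∷ xs) h t≤s s<t+n | false with involved a x in e
... | false rewrite replaceLeftmost-∷ a x (flipFrom (P ∘ suc) a s t xs) (≢⇒≡ᵇ-false (proj₂ (uninvolved⇒≢ {a} {x} e))) =
  cong (x ∷_) (replaceLeftmost-flipFrom (P ∘ suc) a s t xs (Unpaired-a+1-tail {P} h) t≤s s<t+n)
... | true rewrite <⇒<ᵇ-true {t} {suc s} (s≤s t≤s) with t <ᵇ s in t<s
...   | true  rewrite n≡ᵇ1+n a =
  cong (a ∷_) (replaceLeftmost-flipFrom (P ∘ suc) a s (suc t) xs (Unpaired-a+1-tail {P} h) (<ᵇ-sound {t} {s} t<s)
                                        (subst (s <_) (+-suc t _) s<t+n))
...   | false rewrite ≡ᵇ-refl a =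
  cong (a ∷_) (flipFrom-exhausted (P ∘ suc) a s (suc s) (suc t) xs (≤-trans s≤t (n≤1+n t)) (s≤s s≤t))
  where s≤t = <ᵇ-false⇒≥ {t} {s} t<s

replaceLeftmost-flipRow : ∀ P a r → Unpaired-a+1 P a r → Occurs (suc a) r →
                          replaceLeftmost (suc a) (flipRow P a (replaceLeftmost (suc a) r)) ≡ flipRow P a r
replaceLeftmost-flipRow P a r h occ = begin
  replaceLeftmost (suc a) (flipFrom P a s′ 0 r′) ≡⟨ cong (replaceLeftmost (suc a)) (flipFrom-replaceLeftmost P a s′ 0 r h) ⟩
  replaceLeftmost (suc a) (flipFrom P a s′ 0 r)  ≡⟨ replaceLeftmost-flipFrom P a s′ 0 r h z≤n s′<#free ⟩
  flipFrom P a (suc s′) 0 r                      ≡⟨ cong (λ c → flipFrom P a c 0 r) (#free-a+1-replaceLeftmost P a r h occ) ⟩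
  flipRow P a r                                  ∎
  where
  open ≡-Reasoning
  r′ = replaceLeftmost (suc a) r
  s′ = #free-a+1 P a r′
  s′<#free : s′ < #free P a r
  s′<#free = subst (s′ <_) (sym (trans (#free-split P a r) (cong (#free-a P a r +_) (sym (#free-a+1-replaceLeftmost P a r h occ)))))
                   (m≤n+m (suc s′) (#free-a P a r))

lastOr0-max : ∀ r j {x} → Linked _≤_ r → nth r j ≡ just x → x ≤ lastOr0 r
lastOr0-max (y ∷ [])     zero    [-]       refl = ≤-refl
lastOr0-max (y ∷ z ∷ zs) zero    (y≤z ∷ l) refl = ≤-trans y≤z (lastOr0-max (z ∷ zs) zero l refl)
lastOr0-max (y ∷ z ∷ zs) (suc j) (_ ∷ l)   e    = lastOr0-max (z ∷ zs) j l e

lastOr0-occurs : ∀ r → 1 ≤ length r → Occurs (lastOr0 r) r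
lastOr0-occurs (y ∷ [])     _ = zero , refl
lastOr0-occurs (y ∷ z ∷ zs) _ = let (j , e) = lastOr0-occurs (z ∷ zs) (s≤s z≤n) in suc j , e

nth-updRow : ∀ k f S → nth (updRow (suc k) f S) k ≡ Maybe.map f (nth S k)
nth-updRow zero    f []      = refl
nth-updRow zero    f (r ∷ S) = refl
nth-updRow (suc k) f []      = refl
nth-updRow (suc k) f (r ∷ S) = nth-updRow k f S

nth-updRow-≢ : ∀ k f S i → i ≢ k → nth (updRow (suc k) f S) i ≡ nth S i
nth-updRow-≢ k       f []      i       i≢k = refl
nth-updRow-≢ zero    f (r ∷ S) zero    i≢k = contradiction refl i≢k
nth-updRow-≢ zero    f (r ∷ S) (suc i) i≢k = refl
nth-updRow-≢ (suc k) f (r ∷ S) zero    i≢k = refl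
nth-updRow-≢ (suc k) f (r ∷ S) (suc i) i≢k = nth-updRow-≢ k f S i (i≢k ∘ cong suc)

map-updRow : ∀ {B : Set} (g : List ℕ → B) k f S → (∀ r → g (f r) ≡ g r) → map g (updRow (suc k) f S) ≡ map g S
map-updRow g zero    f []      h = refl
map-updRow g zero    f (r ∷ S) h = cong (_∷ map g S) (h r)
map-updRow g (suc k) f []      h = refl
map-updRow g (suc k) f (r ∷ S) h = cong (g r ∷_) (map-updRow g k f S h)

sum-map-updRow : ∀ (g : List ℕ → ℕ) k f S {r} → nth S k ≡ just r →
                 sum (map g (updRow (suc k) f S)) + g r ≡ sum (map g S) + g (f r)
sum-map-updRow g zero    f (r ∷ S)  refl = xy∙z≈zy∙x (g (f r)) (sum (map g S)) (g r)
sum-map-updRow g (suc k) f (r₀ ∷ S) e =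
  trans (+-assoc (g r₀) _ _) (trans (cong (g r₀ +_) (sum-map-updRow g k f S e)) (sym (+-assoc (g r₀) _ _)))

-- Defs.findM runs a `where`-bound loop that cannot be named; unifying against
-- one of its unfoldings recovers it as findFrom λ' S (its argument S is unused).
mutual
  findFrom : List ℕ → Filling → ℕ → Filling → ℕ
  findFrom λ' S = _

  private
    findFrom-unfolds-findM : ∀ λ' r rs → findM λ' (r ∷ rs) ≡ (if lastOr0 r ≡ᵇ 1 then findFrom λ' (r ∷ rs) 2 rs else 1)
    findFrom-unfolds-findM λ' r rs with lastOr0 r ≡ᵇ 1
    ... | false = refl
    ... | true with r ∷ rs | 2
    ...   | S | i = refl

-- row k′ of rs carries the index b + k′
record FirstMismatch (b : ℕ) (rs : Filling) (k : ℕ) : Set where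
  field
    before  : ∀ {k′ r} → k′ < k → nth rs k′ ≡ just r → lastOr0 r ≡ b + k′
    row     : List ℕ
    at      : nth rs k ≡ just row
    differs : lastOr0 row ≢ b + k

FirstMismatch-∷ : ∀ {b r rs k} → lastOr0 r ≡ b → FirstMismatch (suc b) rs k → FirstMismatch b (r ∷ rs) (suc k)
FirstMismatch-∷ {b} {r} {rs} {k} last≡b fm = record
  { before  = λ { {zero} _ refl → trans last≡b (sym (+-identityʳ b))
                ; {suc k′} (s≤s k′<k) e → trans (before k′<k e) (sym (+-suc b k′)) }
  ; row     = row
  ; at      = at
  ; differs = λ p → differs (trans p (+-suc b k))
  }
  where open FirstMismatch fm

FirstMismatch-∷⁻ : ∀ {b r rs k} → FirstMismatch b (r ∷ rs) (suc k) → lastOr0 r ≡ b × FirstMismatch (suc b) rs k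
FirstMismatch-∷⁻ {b} {r} {rs} {k} fm =
  trans (before (s≤s z≤n) refl) (+-identityʳ b) ,
  record
  { before  = λ k′<k e → trans (before (s≤s k′<k) e) (+-suc b _)
  ; row     = row
  ; at      = at
  ; differs = λ p → differs (trans p (sym (+-suc b k)))
  }
  where open FirstMismatch fm

findFrom-cases : ∀ λ' S b rs → findFrom λ' S b rs ≡ length λ' ⊎ ∃[ k ] findFrom λ' S b rs ≡ b + k × FirstMismatch b rs k
findFrom-cases λ' S b []       = inj₁ refl
findFrom-cases λ' S b (r ∷ rs) with lastOr0 r ≡ᵇ b in e
... | false = inj₂ (0 , sym (+-identityʳ b) , record
  { before = λ () ; row = r ; at = refl ; differs = λ p → ≡ᵇ-false⇒≢ e (trans p (+-identityʳ b)) })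
... | true with findFrom-cases λ' S (suc b) rs
...   | inj₁ p               = inj₁ p
...   | inj₂ (k , eq , fm) = inj₂ (suc k , trans eq (sym (+-suc b k)) , FirstMismatch-∷ (≡ᵇ-sound e) fm)

findFrom-FirstMismatch : ∀ λ' S b rs k → FirstMismatch b rs k → findFrom λ' S b rs ≡ b + k
findFrom-FirstMismatch λ' S b (r ∷ rs) zero fm with refl ← FirstMismatch.at fm
  rewrite ≢⇒≡ᵇ-false (λ p → FirstMismatch.differs fm (trans p (sym (+-identityʳ b)))) = sym (+-identityʳ b)
findFrom-FirstMismatch λ' S b (r ∷ rs) (suc k) fm with FirstMismatch-∷⁻ fm
... | last≡b , fm′ rewrite last≡b | ≡ᵇ-refl b = trans (findFrom-FirstMismatch λ' S (suc b) rs k fm′) (sym (+-suc b k))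

-- The transposition s_a on one-line words, and the sign

-- sσ a is map (τ a).
τ : ℕ → ℕ → ℕ
τ a x = if x ≡ᵇ a then suc a else if x ≡ᵇ suc a then a else x

τ-a : ∀ a → τ a a ≡ suc a
τ-a a rewrite ≡ᵇ-refl a = refl

τ-a+1 : ∀ a → τ a (suc a) ≡ a
τ-a+1 a rewrite 1+n≡ᵇn a | ≡ᵇ-refl a = refl

τ-other : ∀ a {x} → x ≢ a → x ≢ suc a → τ a x ≡ x
τ-other a x≢a x≢a+1 rewrite ≢⇒≡ᵇ-false x≢a | ≢⇒≡ᵇ-false x≢a+1 = refl

data TranspositionCase (a x : ℕ) : Set where
  at-a   : x ≡ a → TranspositionCase a x
  at-a+1 : x ≡ suc a → TranspositionCase a x
  fixed  : x ≢ a → x ≢ suc a → TranspositionCase a x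

transpositionCase : ∀ a x → TranspositionCase a x
transpositionCase a x with x ≟ a | x ≟ suc a
... | yes x≡a | _          = at-a x≡a
... | no x≢a  | yes x≡a+1 = at-a+1 x≡a+1
... | no x≢a  | no x≢a+1  = fixed x≢a x≢a+1

τ-involutive : ∀ a x → τ a (τ a x) ≡ x
τ-involutive a x with transpositionCase a x
... | at-a refl        rewrite τ-a a   = τ-a+1 a
... | at-a+1 refl      rewrite τ-a+1 a = τ-a a
... | fixed x≢a x≢a+1 rewrite τ-other a x≢a x≢a+1 = τ-other a x≢a x≢a+1

sσ-involutive : ∀ a σ → sσ a (sσ a σ) ≡ σ
sσ-involutive a []      = refl
sσ-involutive a (x ∷ σ) = cong₂ _∷_ (τ-involutive a x) (sσ-involutive a σ)

τ-≡ᵇ : ∀ a x v → (τ a x ≡ᵇ v) ≡ (x ≡ᵇ τ a v)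
τ-≡ᵇ a x v with x ≟ τ a v
... | yes refl rewrite τ-involutive a v | ≡ᵇ-refl v | ≡ᵇ-refl (τ a v) = refl
... | no x≢τv  rewrite ≢⇒≡ᵇ-false x≢τv =
  ≢⇒≡ᵇ-false {τ a x} {v} (λ τx≡v → x≢τv (trans (sym (τ-involutive a x)) (cong (τ a) τx≡v)))

posOf-sσ : ∀ a σ v → posOf (sσ a σ) v ≡ posOf σ (τ a v)
posOf-sσ a []      v = refl
posOf-sσ a (x ∷ σ) v rewrite τ-≡ᵇ a x v = cong (λ p → if x ≡ᵇ τ a v then 1 else suc p) (posOf-sσ a σ v)

get₁-sσ : ∀ a σ p → 1 ≤ a → get₁ (sσ a σ) p ≡ τ a (get₁ σ p)
get₁-sσ (suc a) σ zero    _ = refl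
get₁-sσ (suc a) σ (suc i) _ rewrite nth-map (τ (suc a)) σ i with nth σ i
... | just x  = refl
... | nothing = refl

get₁-posOf : ∀ σ v → Occurs v σ → get₁ σ (posOf σ v) ≡ v
get₁-posOf (x ∷ σ) v occ with x ≡ᵇ v in e
... | true = ≡ᵇ-sound e
get₁-posOf (x ∷ σ) v (zero  , refl) | false rewrite ≡ᵇ-refl x with () ← e
get₁-posOf (x ∷ σ) v (suc j , occ)  | false = trans (shift σ occ) (get₁-posOf σ v (j , occ))
  where
  shift : ∀ σ {j} → nth σ j ≡ just v → get₁ (x ∷ σ) (suc (posOf σ v)) ≡ get₁ σ (posOf σ v)
  shift (y ∷ σ′) _ with y ≡ᵇ v
  ... | true  = refl
  ... | false = refl

range : ℕ → ℕ → List ℕ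
range b zero    = []
range b (suc n) = b ∷ range (suc b) n

applyUpTo-range : ∀ (f : ℕ → ℕ) b n → (∀ i → f i ≡ b + i) → applyUpTo f n ≡ range b n
applyUpTo-range f b zero    _ = refl
applyUpTo-range f b (suc n) h =
  cong₂ _∷_ (trans (h 0) (+-identityʳ b)) (applyUpTo-range (f ∘ suc) (suc b) n (λ i → trans (h (suc i)) (+-suc b i)))

map-suc-upTo : ∀ n → map suc (upTo n) ≡ range 1 n
map-suc-upTo n = trans (map-applyUpTo id suc n) (applyUpTo-range suc 1 n (λ _ → refl))

range-≥ : ∀ b n → All (b ≤_) (range b n)
range-≥ b zero    = []
range-≥ b (suc n) = ≤-refl ∷ All.map (≤-trans (n≤1+n b)) (range-≥ (suc b) n)

count-range-below : ∀ v b n → v < b → count v (range b n) ≡ 0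
count-range-below v b zero    v<b = refl
count-range-below v b (suc n) v<b rewrite count-∷ v b (range (suc b) n) | ≢⇒≡ᵇ-false (>⇒≢ v<b) =
  count-range-below v (suc b) n (≤-trans v<b (n≤1+n b))

count-range : ∀ v b n → b ≤ v → v < b + n → count v (range b n) ≡ 1
count-range v b zero    b≤v v<b+0 rewrite +-identityʳ b = contradiction b≤v (<⇒≱ v<b+0)
count-range v b (suc n) b≤v v<b+n rewrite count-∷ v b (range (suc b) n) with m≤n⇒m<n∨m≡n b≤v
... | inj₂ refl rewrite ≡ᵇ-refl v = cong suc (count-range-below v (suc v) n (n<1+n v))
... | inj₁ b<v  rewrite ≢⇒≡ᵇ-false (<⇒≢ b<v) = count-range v (suc b) n b<v (subst (v <_) (+-suc b n) v<b+n)

map-τ-above : ∀ a xs → All (suc (suc a) ≤_) xs → map (τ a) xs ≡ xs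
map-τ-above a []       []           = refl
map-τ-above a (x ∷ xs) (a+2≤x ∷ h) =
  cong₂ _∷_ (τ-other a (λ x≡a → 1+n≰n (≤-trans (n≤1+n _) (subst (_ ≤_) x≡a a+2≤x)))
                       (λ x≡a+1 → 1+n≰n (subst (_ ≤_) x≡a+1 a+2≤x)))
            (map-τ-above a xs h)

map-τ-range : ∀ a b n → b ≤ a → suc a < b + n → map (τ a) (range b n) ↭ range b n
map-τ-range a b zero    b≤a a+1<b+0 rewrite +-identityʳ b = contradiction (≤-trans b≤a (n≤1+n a)) (<⇒≱ a+1<b+0)
map-τ-range a b (suc n) b≤a a+1<b+n with m≤n⇒m<n∨m≡n b≤a
... | inj₁ b<a rewrite τ-other a (<⇒≢ b<a) (<⇒≢ (≤-trans b<a (n≤1+n a))) =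
  prep b (map-τ-range a (suc b) n b<a (subst (suc a <_) (+-suc b n) a+1<b+n))
map-τ-range a b (suc zero)    b≤a a+1<b+1 | inj₂ refl rewrite +-comm b 1 = contradiction a+1<b+1 (n≮n (suc b))
map-τ-range a b (suc (suc n)) b≤a _       | inj₂ refl
  rewrite τ-a b | τ-a+1 b | map-τ-above b (range (suc (suc b)) n) (range-≥ (suc (suc b)) n) = swap (suc b) b ↭-refl

IsPerm-sσ : ∀ ℓ a σ → IsPerm ℓ σ → 1 ≤ a → suc a ≤ ℓ → IsPerm ℓ (sσ a σ)
IsPerm-sσ ℓ a σ σ↭ 1≤a a+1≤ℓ rewrite map-suc-upTo ℓ = ↭-trans (map⁺ (τ a) σ↭) (map-τ-range a 1 ℓ 1≤a (s≤s a+1≤ℓ))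

IsPerm-count : ∀ {ℓ σ} → IsPerm ℓ σ → ∀ v → 1 ≤ v → v ≤ ℓ → count v σ ≡ 1
IsPerm-count {ℓ} σ↭ v 1≤v v≤ℓ =
  trans (count-↭ v σ↭) (subst (λ l → count v l ≡ 1) (sym (map-suc-upTo ℓ)) (count-range v 1 ℓ 1≤v (s≤s v≤ℓ)))

#below : ℕ → List ℕ → ℕ
#below x ys = length (filter (_<? x) ys)

#below-∷ : ∀ x y ys → #below x (y ∷ ys) ≡ 𝟙 (y <ᵇ x) + #below x ys
#below-∷ x y ys with y <ᵇ x
... | true  = refl
... | false = refl

guard : Bool → ℕ → ℕ
guard b n = if b then n else 0

guard-+ : ∀ b m n → guard b (m + n) ≡ guard b m + guard b n
guard-+ true  m n = refl
guard-+ false m n = refl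

<ᵇ-cong : ∀ {m n m′ n′} → (m < n → m′ < n′) → (m′ < n′ → m < n) → (m <ᵇ n) ≡ (m′ <ᵇ n′)
<ᵇ-cong {m} {n} {m′} {n′} f g =
  ⇔→≡ (mk⇔ (<⇒<ᵇ-true ∘ f ∘ <ᵇ-sound {m} {n}) (<⇒<ᵇ-true ∘ g ∘ <ᵇ-sound {m′} {n′}))

-- s_a preserves the relative order of every pair of values except {a, a+1}
τ-inversion : ∀ a x y → 𝟙 (τ a y <ᵇ τ a x) + guard (x ≡ᵇ suc a) (𝟙 (y ≡ᵇ a))
                      ≡ 𝟙 (y <ᵇ x) + guard (x ≡ᵇ a) (𝟙 (y ≡ᵇ suc a))
τ-inversion a x y with transpositionCase a x | transpositionCase a y
... | at-a refl | at-a refl rewrite τ-a a | n≡ᵇ1+n a | ≡ᵇ-refl a = refl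
... | at-a refl | at-a+1 refl rewrite τ-a a | τ-a+1 a | n≡ᵇ1+n a | ≡ᵇ-refl a | <⇒<ᵇ-true {a} {suc a} ≤-refl
                                    | ≥⇒<ᵇ-false {suc a} {a} (n≤1+n a) = refl
... | at-a refl | fixed y≢a y≢a+1 rewrite τ-a a | τ-other a y≢a y≢a+1 | n≡ᵇ1+n a | ≡ᵇ-refl a | ≢⇒≡ᵇ-false y≢a+1
                                        | +-identityʳ (𝟙 (y <ᵇ suc a)) | +-identityʳ (𝟙 (y <ᵇ a)) =
  cong 𝟙 (<ᵇ-cong (λ y<a+1 → ≤∧≢⇒< (≤-pred y<a+1) y≢a) (λ y<a → ≤-trans y<a (n≤1+n a)))
... | at-a+1 refl | at-a refl rewrite τ-a a | τ-a+1 a | 1+n≡ᵇn a | ≡ᵇ-refl a | <⇒<ᵇ-true {a} {suc a} ≤-refl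
                                    | ≥⇒<ᵇ-false {suc a} {a} (n≤1+n a) = refl
... | at-a+1 refl | at-a+1 refl rewrite τ-a+1 a | 1+n≡ᵇn a | ≡ᵇ-refl a = refl
... | at-a+1 refl | fixed y≢a y≢a+1 rewrite τ-a+1 a | τ-other a y≢a y≢a+1 | 1+n≡ᵇn a | ≡ᵇ-refl a | ≢⇒≡ᵇ-false y≢a
                                          | +-identityʳ (𝟙 (y <ᵇ a)) | +-identityʳ (𝟙 (y <ᵇ suc a)) =
  cong 𝟙 (<ᵇ-cong (λ y<a → ≤-trans y<a (n≤1+n a)) (λ y<a+1 → ≤∧≢⇒< (≤-pred y<a+1) y≢a))
... | fixed x≢a x≢a+1 | at-a refl rewrite τ-other a x≢a x≢a+1 | τ-a a | ≢⇒≡ᵇ-false x≢a | ≢⇒≡ᵇ-false x≢a+1 =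
  cong (λ b → 𝟙 b + 0) (<ᵇ-cong (≤-trans (n≤1+n (suc a))) (λ a<x → ≤∧≢⇒< a<x (x≢a+1 ∘ sym)))
... | fixed x≢a x≢a+1 | at-a+1 refl rewrite τ-other a x≢a x≢a+1 | τ-a+1 a | ≢⇒≡ᵇ-false x≢a | ≢⇒≡ᵇ-false x≢a+1 =
  cong (λ b → 𝟙 b + 0) (<ᵇ-cong (λ a<x → ≤∧≢⇒< a<x (x≢a+1 ∘ sym)) (≤-trans (n≤1+n (suc a))))
... | fixed x≢a x≢a+1 | fixed y≢a y≢a+1 rewrite τ-other a x≢a x≢a+1 | τ-other a y≢a y≢a+1
                                              | ≢⇒≡ᵇ-false x≢a | ≢⇒≡ᵇ-false x≢a+1 = refl

τ-#below : ∀ a x ys → #below (τ a x) (sσ a ys) + guard (x ≡ᵇ suc a) (count a ys)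
                    ≡ #below x ys + guard (x ≡ᵇ a) (count (suc a) ys)
τ-#below a x [] with x ≡ᵇ suc a | x ≡ᵇ a
... | true  | true  = refl
... | true  | false = refl
... | false | true  = refl
... | false | false = refl
τ-#below a x (y ∷ ys)
  rewrite #below-∷ (τ a x) (τ a y) (sσ a ys) | #below-∷ x y ys | count-∷ a y ys | count-∷ (suc a) y ys
        | guard-+ (x ≡ᵇ suc a) (𝟙 (y ≡ᵇ a)) (count a ys) | guard-+ (x ≡ᵇ a) (𝟙 (y ≡ᵇ suc a)) (count (suc a) ys)
        | interchange (𝟙 (τ a y <ᵇ τ a x)) (#below (τ a x) (sσ a ys))
                      (guard (x ≡ᵇ suc a) (𝟙 (y ≡ᵇ a))) (guard (x ≡ᵇ suc a) (count a ys))
        | interchange (𝟙 (y <ᵇ x)) (#below x ys) (guard (x ≡ᵇ a) (𝟙 (y ≡ᵇ suc a))) (guard (x ≡ᵇ a) (count (suc a) ys))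
        | τ-inversion a x y | τ-#below a x ys = refl

#a-then-a+1 #a+1-then-a : ℕ → List ℕ → ℕ
#a-then-a+1 a []       = 0
#a-then-a+1 a (x ∷ xs) = guard (x ≡ᵇ a) (count (suc a) xs) + #a-then-a+1 a xs
#a+1-then-a a []       = 0
#a+1-then-a a (x ∷ xs) = guard (x ≡ᵇ suc a) (count a xs) + #a+1-then-a a xs

inversions-sσ : ∀ a xs → inversions (sσ a xs) + #a+1-then-a a xs ≡ inversions xs + #a-then-a+1 a xs
inversions-sσ a []       = refl
inversions-sσ a (x ∷ xs)
  rewrite interchange (#below (τ a x) (sσ a xs)) (inversions (sσ a xs)) (guard (x ≡ᵇ suc a) (count a xs)) (#a+1-then-a a xs)
        | interchange (#below x xs) (inversions xs) (guard (x ≡ᵇ a) (count (suc a) xs)) (#a-then-a+1 a xs)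
        | τ-#below a x xs | inversions-sσ a xs = refl

#a-then-a+1+#a+1-then-a : ∀ a xs → #a-then-a+1 a xs + #a+1-then-a a xs ≡ count a xs * count (suc a) xs
#a-then-a+1+#a+1-then-a a []       = refl
#a-then-a+1+#a+1-then-a a (x ∷ xs) rewrite count-∷ a x xs | count-∷ (suc a) x xs with transpositionCase a x
... | at-a refl rewrite ≡ᵇ-refl a | n≡ᵇ1+n a =
  trans (+-assoc (count (suc a) xs) _ _) (cong (count (suc a) xs +_) (#a-then-a+1+#a+1-then-a a xs))
... | at-a+1 refl rewrite ≡ᵇ-refl a | 1+n≡ᵇn a = begin
  #a-then-a+1 a xs + (count a xs + #a+1-then-a a xs) ≡⟨ +-exchange (#a-then-a+1 a xs) (count a xs) _ ⟩
  count a xs + (#a-then-a+1 a xs + #a+1-then-a a xs) ≡⟨ cong (count a xs +_) (#a-then-a+1+#a+1-then-a a xs) ⟩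
  count a xs + count a xs * count (suc a) xs         ≡⟨ sym (*-suc (count a xs) (count (suc a) xs)) ⟩
  count a xs * suc (count (suc a) xs)                ∎
  where open ≡-Reasoning
... | fixed x≢a x≢a+1 rewrite ≢⇒≡ᵇ-false x≢a | ≢⇒≡ᵇ-false x≢a+1 = #a-then-a+1+#a+1-then-a a xs

sgn-sσ : ∀ a σ → count a σ ≡ 1 → count (suc a) σ ≡ 1 → sgn (sσ a σ) ≡ - sgn σ
sgn-sσ a σ one-a one-a+1 with #a-then-a+1 a σ | #a+1-then-a a σ | #a-then-a+1+#a+1-then-a a σ | inversions-sσ a σ
... | 1 | 0 | _ | inv+0≡inv+1 = cong sgnℕ (trans (sym (+-identityʳ _)) (trans inv+0≡inv+1 (+-comm (inversions σ) 1)))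
... | 0 | 1 | _ | inv+1≡inv+0 =
  trans (sym (ℤ.neg-involutive _))
        (cong -_ (cong sgnℕ (sym (trans (sym (+-identityʳ (inversions σ))) (trans (sym inv+1≡inv+0) (+-comm _ 1))))))
... | 0 | 0 | total | _ rewrite one-a | one-a+1 with () ← total
... | 1 | suc _ | total | _ rewrite one-a | one-a+1 with () ← total
... | 0 | suc (suc _) | total | _ rewrite one-a | one-a+1 with () ← total
... | suc (suc _) | _ | total | _ rewrite one-a | one-a+1 with () ← total

-- The involution χ

content-transfer : ∀ (cU cS M v w p : ℕ) → cU + w ≡ cS + v →
                   ℤ.+ cS ≡ (ℤ.+ M ℤ.+ ℤ.+ w) ℤ.- ℤ.+ p → ℤ.+ cU ≡ (ℤ.+ M ℤ.+ ℤ.+ v) ℤ.- ℤ.+ p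
content-transfer cU cS M v w p cU+w≡cS+v cS≡ = begin
  ℤ.+ cU                                              ≡⟨ cancel (ℤ.+ cU) (ℤ.+ w) ⟩
  (ℤ.+ cU ℤ.+ ℤ.+ w) ℤ.- ℤ.+ w                        ≡⟨ cong (ℤ._- ℤ.+ w) cast ⟩
  (ℤ.+ cS ℤ.+ ℤ.+ v) ℤ.- ℤ.+ w                        ≡⟨ cong (λ c → (c ℤ.+ ℤ.+ v) ℤ.- ℤ.+ w) cS≡ ⟩
  (((ℤ.+ M ℤ.+ ℤ.+ w) ℤ.- ℤ.+ p) ℤ.+ ℤ.+ v) ℤ.- ℤ.+ w ≡⟨ regroup (ℤ.+ M) (ℤ.+ w) (ℤ.+ p) (ℤ.+ v) ⟩
  (ℤ.+ M ℤ.+ ℤ.+ v) ℤ.- ℤ.+ p                         ∎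
  where
  open ≡-Reasoning
  open +-*-Solver
  cast : ℤ.+ cU ℤ.+ ℤ.+ w ≡ ℤ.+ cS ℤ.+ ℤ.+ v
  cast = trans (sym (ℤ.pos-+ cU w)) (trans (cong ℤ.+_ cU+w≡cS+v) (ℤ.pos-+ cS v))
  cancel : ∀ c w → c ≡ (c ℤ.+ w) ℤ.- w
  cancel = solve 2 (λ c w → c := (c :+ w) :- w) refl
  regroup : ∀ M w p v → (((M ℤ.+ w) ℤ.- p) ℤ.+ v) ℤ.- w ≡ (M ℤ.+ v) ℤ.- p
  regroup = solve 4 (λ M w p v → (((M :+ w) :- p) :+ v) :- w := (M :+ v) :- p) refl

SignReversingInvolutionAt : (Pair → Set) → (Pair → Pair) → Pair → Set
SignReversingInvolutionAt B f p = B (f p) × f (f p) ≡ p × (f p ≢ p → sgn (proj₂ (f p)) ≡ - sgn (proj₂ p))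

fixed-point : ∀ {B f p} → f p ≡ p → B p → SignReversingInvolutionAt B f p
fixed-point {B} {f} fp≡p Bp = subst B (sym fp≡p) Bp , trans (cong f fp≡p) fp≡p , λ fp≢p → contradiction fp≡p fp≢p

swapped : ∀ {B f p q} → f p ≡ q → f q ≡ p → B q → sgn (proj₂ q) ≡ - sgn (proj₂ p) → SignReversingInvolutionAt B f p
swapped refl fq≡p Bq sgn-q = Bq , fq≡p , λ _ → sgn-q

χ-fixed : ∀ λ' μ S σ → findM λ' S ≡ length λ' → χ λ' μ (S , σ) ≡ (S , σ)
χ-fixed λ' μ S σ m≡ℓ rewrite m≡ℓ | ≡ᵇ-refl (length λ') = refl

χ-moves : ∀ λ' μ S σ {k} (fm : FirstMismatch 1 S k) {a} → lastOr0 (FirstMismatch.row fm) ≡ suc a → suc k ≢ length λ' →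
          χ λ' μ (S , σ) ≡ (BK a (updRow (suc k) (replaceLeftmost (suc a)) S) , sσ a σ)
χ-moves λ' μ S σ {k} fm last≡ k+1≢ℓ
  rewrite findFrom-FirstMismatch λ' S 1 S k fm | ≢⇒≡ᵇ-false k+1≢ℓ | FirstMismatch.at fm | last≡ = refl

-- The case where χ moves (S , σ): row k (0-based) is the first mismatch; its largest entry is a+1.
module Move {n λ' μ S σ} (λ-partition : IsPartition n λ') (inB : InB λ' μ (S , σ))
            {k} (mismatch : FirstMismatch 1 S k) (moves : suc k ≢ length λ') where

  open FirstMismatch mismatch renaming (row to r; at to S[k]≡r)

  private
    ssyt = proj₁ inB
    posS = proj₁ (proj₂ ssyt)
    sortedS = proj₁ (proj₂ (proj₂ ssyt))

  ssS : SemiStandard S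
  ssS = subst (Linked _) (sym (proj₁ ssyt)) (proj₁ (proj₂ λ-partition)) , sortedS , proj₂ (proj₂ (proj₂ ssyt))

  r-sorted : Linked _≤_ r
  r-sorted = All-nth k sortedS S[k]≡r

  r-nonempty : 1 ≤ length r
  r-nonempty = All-nth k (proj₁ λ-partition) (subst (λ l → nth l k ≡ just (length r)) (proj₁ ssyt) (nth-map-just length S k S[k]≡r))

  last-occurs : Occurs (lastOr0 r) r
  last-occurs = lastOr0-occurs r r-nonempty

  k+2≤last : suc (suc k) ≤ lastOr0 r
  k+2≤last = ≤∧≢⇒< (entry-≥ ssS posS k _ (trans (entry-just S k _ S[k]≡r) (proj₂ last-occurs))) (differs ∘ sym)

  a : ℕ
  a = lastOr0 r ∸ 1

  a+1≡last : suc a ≡ lastOr0 r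
  a+1≡last = m+[n∸m]≡n (≤-trans (s≤s z≤n) k+2≤last)

  k<a : k < a
  k<a = ≤-pred (subst (suc (suc k) ≤_) (sym a+1≡last) k+2≤last)

  1≤a : 1 ≤ a
  1≤a = ≤-trans (s≤s z≤n) k<a

  -- rows above k end in their index, which is less than a
  above-<a : ∀ {i} j {x} → i < k → entry S i j ≡ just x → x < a
  above-<a {i} j i<k e with entry-row S i j e
  ... | rᵢ , erᵢ , ex =
    <-≤-trans (s≤s (≤-trans (subst (_ ≤_) (before i<k erᵢ) (lastOr0-max rᵢ j (All-nth i sortedS erᵢ) ex)) i<k)) k<a

  r-≤a+1 : All (_≤ suc a) r
  r-≤a+1 = nth⇒All r (λ j e → subst (_ ≤_) (sym a+1≡last) (lastOr0-max r j r-sorted e))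

  a+1-occurs : Occurs (suc a) r
  a+1-occurs = subst (λ v → Occurs v r) (sym a+1≡last) last-occurs

  a+1-unpaired : Unpaired-a+1 (pairedAt S a) a r
  a+1-unpaired j e with pairedAt S a j in p
  ... | false = refl
  ... | true with pairedAt⇒ ssS a j p
  ...   | i , e₁ , e₂ with refl ← column-injective ssS j e₂ (trans (entry-just S k j S[k]≡r) e) =
    contradiction (above-<a j (n<1+n i) e₁) (n≮n a)

  S′ : Filling
  S′ = updRow (suc k) (replaceLeftmost (suc a)) S

  r′ : List ℕ
  r′ = replaceLeftmost (suc a) r

  S′[k]≡r′ : nth S′ k ≡ just r′
  S′[k]≡r′ = trans (nth-updRow k _ S) (cong (Maybe.map _) S[k]≡r)

  entry-S′⁻ : ∀ i j {y} → entry S′ i j ≡ just y → ∃[ x ] entry S i j ≡ just x × (y ≡ x ⊎ (i ≡ k × x ≡ suc a × y ≡ a))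
  entry-S′⁻ i j e with i ≟ k
  ... | no i≢k = _ , trans (entry-≡ S S′ i j (sym (nth-updRow-≢ k _ S i i≢k))) e , inj₁ refl
  ... | yes refl with nth-replaceLeftmost⁻ a r j (trans (sym (entry-just S′ k j S′[k]≡r′)) e)
  ...   | x , ex , inj₁ y≡x = x , trans (entry-just S k j S[k]≡r) ex , inj₁ y≡x
  ...   | x , ex , inj₂ (x≡a+1 , y≡a) = x , trans (entry-just S k j S[k]≡r) ex , inj₂ (refl , x≡a+1 , y≡a)

  entry-S′ : ∀ i j {x} → entry S i j ≡ just x → ∃[ y ] entry S′ i j ≡ just y × (y ≡ x ⊎ (i ≡ k × x ≡ suc a × y ≡ a))
  entry-S′ i j e with i ≟ k
  ... | no i≢k = _ , trans (entry-≡ S′ S i j (nth-updRow-≢ k _ S i i≢k)) e , inj₁ refl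
  ... | yes refl with nth-replaceLeftmost a r j (trans (sym (entry-just S k j S[k]≡r)) e)
  ...   | y , ey , inj₁ y≡x = y , trans (entry-just S′ k j S′[k]≡r′) ey , inj₁ y≡x
  ...   | y , ey , inj₂ (x≡a+1 , y≡a) = y , trans (entry-just S′ k j S′[k]≡r′) ey , inj₂ (refl , x≡a+1 , y≡a)

  map-length-S′ : map length S′ ≡ map length S
  map-length-S′ = map-updRow length k _ S (length-replaceLeftmost (suc a))

  ssS′ : SemiStandard S′
  ssS′ = subst (Linked _) (sym map-length-S′) (proj₁ ssS) , rows , columns
    where
    rows : All (Linked _≤_) S′
    rows = nth⇒All S′ λ i {rᵢ} e → case i ≟ k of λ
      { (yes refl) → subst (Linked _≤_) (just-injective (trans (sym S′[k]≡r′) e)) (replaceLeftmost-sorted a r r-sorted r-≤a+1)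
      ; (no i≢k)   → All-nth i sortedS (trans (sym (nth-updRow-≢ k _ S i i≢k)) e) }
    columns : ∀ i j x′ y′ → entry S′ i j ≡ just x′ → entry S′ (suc i) j ≡ just y′ → x′ < y′
    columns i j x′ y′ e₁ e₂ with entry-S′⁻ i j e₁ | entry-S′⁻ (suc i) j e₂
    ... | x , ex , c₁ | y , ey , c₂ with proj₂ (proj₂ ssS) i j x y ex ey | c₁ | c₂
    ... | x<y | inj₁ refl               | inj₁ refl               = x<y
    ... | x<y | inj₂ (refl , refl , refl) | inj₁ refl             = <-trans (n<1+n a) x<y
    ... | x<y | inj₁ refl               | inj₂ (refl , refl , refl) = above-<a j (n<1+n i) ex
    ... | x<y | inj₂ (refl , _ , _)     | inj₂ (i+1≡i , _ , _)    = contradiction i+1≡i 1+n≢n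

  posS′ : All (All (1 ≤_)) S′
  posS′ = nth⇒All S′ λ i {rᵢ} e → case i ≟ k of λ
    { (yes refl) → subst (All (1 ≤_)) (just-injective (trans (sym S′[k]≡r′) e)) (replaceLeftmost-All a r 1≤a (All-nth k posS S[k]≡r))
    ; (no i≢k)   → All-nth i posS (trans (sym (nth-updRow-≢ k _ S i i≢k)) e) }

  -- lowering an unpaired a+1 to a creates no new pair: the entry above it is < a
  pairedAt-S′ : ∀ j → pairedAt S′ a j ≡ pairedAt S a j
  pairedAt-S′ j = ⇔→≡ (mk⇔ to from)
    where
    to : pairedAt S′ a j ≡ true → pairedAt S a j ≡ true
    to p with pairedAt⇒ ssS′ a j p
    ... | i , e₁ , e₂ with entry-S′⁻ i j e₁ | entry-S′⁻ (suc i) j e₂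
    ... | _ , _ , _ | _ , _ , inj₂ (_ , _ , a+1≡a) = contradiction a+1≡a 1+n≢n
    ... | _ , ex , inj₁ refl | _ , ey , inj₁ refl = ⇒pairedAt S a i j ex ey
    ... | _ , ex , inj₂ (refl , refl , refl) | _ , ey , inj₁ refl =
      contradiction (proj₂ (proj₂ ssS) k j _ _ ex ey) (n≮n (suc a))
    from : pairedAt S a j ≡ true → pairedAt S′ a j ≡ true
    from p with pairedAt⇒ ssS a j p
    ... | i , e₁ , e₂ with entry-S′ i j e₁ | entry-S′ (suc i) j e₂
    ... | _ , _ , inj₂ (_ , a≡a+1 , _) | _ = contradiction (sym a≡a+1) 1+n≢n
    ... | _ , ey₁ , inj₁ refl | _ , ey₂ , inj₁ refl = ⇒pairedAt S′ a i j ey₁ ey₂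
    ... | _ , _ , inj₁ refl | _ , _ , inj₂ (refl , _ , _) = contradiction (above-<a j (n<1+n i) e₁) (n≮n a)

  P : ℕ → Bool
  P = pairedAt S a

  U : Filling
  U = BK a S′

  U≡flipRows : U ≡ flipRows a S′
  U≡flipRows = BK≡flipRows a S′

  U≡ : U ≡ map (flipRow P a) S′
  U≡ = trans U≡flipRows (map-cong-nth S′ (λ _ _ → flipRow-cong a _ pairedAt-S′))

  ssU : SemiStandard U
  ssU = subst SemiStandard (sym U≡flipRows) (flipRows-SemiStandard ssS′ a)

  IsSSYT-U : IsSSYT λ' U
  IsSSYT-U = subst (IsSSYT λ') (sym U≡flipRows)
    ( trans (map-length-flipRows a S′) (trans map-length-S′ (proj₁ ssyt))
    , flipRows-pos a S′ 1≤a posS′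
    , flipRows-rows-sorted ssS′ a
    , flipRows-columns ssS′ a )

  content-S′ : ∀ v → contentOf S′ v + 𝟙 (v ≡ᵇ suc a) ≡ contentOf S v + 𝟙 (v ≡ᵇ a)
  content-S′ v = +-cancelʳ-≡ (count v r) _ _ (begin
    contentOf S′ v + 𝟙 (v ≡ᵇ suc a) + count v r   ≡⟨ +-exchangeʳ (contentOf S′ v) _ _ ⟩
    contentOf S′ v + count v r + 𝟙 (v ≡ᵇ suc a)   ≡⟨ cong (_+ 𝟙 (v ≡ᵇ suc a)) (sum-map-updRow (count v) k _ S S[k]≡r) ⟩
    contentOf S v + count v r′ + 𝟙 (v ≡ᵇ suc a)   ≡⟨ +-assoc (contentOf S v) _ _ ⟩
    contentOf S v + (count v r′ + 𝟙 (v ≡ᵇ suc a)) ≡⟨ cong (contentOf S v +_) (count-replaceLeftmost a r v a+1-occurs) ⟩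
    contentOf S v + (count v r + 𝟙 (v ≡ᵇ a))      ≡⟨ sym (+-assoc (contentOf S v) _ _) ⟩
    contentOf S v + count v r + 𝟙 (v ≡ᵇ a)        ≡⟨ +-exchangeʳ (contentOf S v) _ _ ⟩
    contentOf S v + 𝟙 (v ≡ᵇ a) + count v r        ∎)
    where open ≡-Reasoning

  content-U : ∀ v → contentOf U v + τ a v ≡ contentOf S (τ a v) + v
  content-U v rewrite U≡flipRows with transpositionCase a v
  ... | at-a refl rewrite τ-a a | content-flipRows-a ssS′ a = begin
    contentOf S′ (suc a) + suc a        ≡⟨ +-suc _ a ⟩
    suc (contentOf S′ (suc a) + a)      ≡⟨ cong (_+ a) (+-comm 1 _) ⟩
    contentOf S′ (suc a) + 1 + a        ≡⟨ cong (λ b → contentOf S′ (suc a) + 𝟙 b + a) (sym (≡ᵇ-refl (suc a))) ⟩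
    contentOf S′ (suc a) + 𝟙 (suc a ≡ᵇ suc a) + a ≡⟨ cong (_+ a) (content-S′ (suc a)) ⟩
    contentOf S (suc a) + 𝟙 (suc a ≡ᵇ a) + a      ≡⟨ cong (λ b → contentOf S (suc a) + 𝟙 b + a) (1+n≡ᵇn a) ⟩
    contentOf S (suc a) + 0 + a         ≡⟨ cong (_+ a) (+-identityʳ _) ⟩
    contentOf S (suc a) + a             ∎
    where open ≡-Reasoning
  ... | at-a+1 refl rewrite τ-a+1 a | content-flipRows-a+1 ssS′ a = begin
    contentOf S′ a + a                  ≡⟨ cong (_+ a) (sym (+-identityʳ _)) ⟩
    contentOf S′ a + 0 + a              ≡⟨ cong (λ b → contentOf S′ a + 𝟙 b + a) (sym (n≡ᵇ1+n a)) ⟩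
    contentOf S′ a + 𝟙 (a ≡ᵇ suc a) + a ≡⟨ cong (_+ a) (content-S′ a) ⟩
    contentOf S a + 𝟙 (a ≡ᵇ a) + a      ≡⟨ cong (λ b → contentOf S a + 𝟙 b + a) (≡ᵇ-refl a) ⟩
    contentOf S a + 1 + a               ≡⟨ +-assoc (contentOf S a) 1 a ⟩
    contentOf S a + suc a               ∎
    where open ≡-Reasoning
  ... | fixed v≢a v≢a+1 rewrite τ-other a v≢a v≢a+1 | content-flipRows-other a S′ v≢a v≢a+1 =
    cong (_+ v) (begin
      contentOf S′ v                      ≡⟨ sym (+-identityʳ _) ⟩
      contentOf S′ v + 𝟙 false            ≡⟨ cong (λ b → contentOf S′ v + 𝟙 b) (sym (≢⇒≡ᵇ-false v≢a+1)) ⟩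
      contentOf S′ v + 𝟙 (v ≡ᵇ suc a)     ≡⟨ content-S′ v ⟩
      contentOf S v + 𝟙 (v ≡ᵇ a)          ≡⟨ cong (λ b → contentOf S v + 𝟙 b) (≢⇒≡ᵇ-false v≢a) ⟩
      contentOf S v + 0                   ≡⟨ +-identityʳ _ ⟩
      contentOf S v                       ∎)
    where open ≡-Reasoning

  ℓ : ℕ
  ℓ = length μ

  σ-perm : IsPerm ℓ σ
  σ-perm = proj₁ (proj₂ inB)

  content-S-Δ : ∀ v → 1 ≤ v → v ≤ ℓ → ℤ.+ contentOf S v ≡ Δ μ σ (posOf σ v)
  content-S-Δ = proj₁ (proj₂ (proj₂ inB))

  content-S-0 : ∀ v → ℓ < v → contentOf S v ≡ 0
  content-S-0 = proj₂ (proj₂ (proj₂ inB))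

  a+1≤ℓ : suc a ≤ ℓ
  a+1≤ℓ with suc a ≤? ℓ
  ... | yes a+1≤ℓ = a+1≤ℓ
  ... | no a+1≰ℓ = contradiction (subst (1 ≤_) (content-S-0 (suc a) (≰⇒> a+1≰ℓ)) a+1-counted) λ ()
    where
    a+1-counted : 1 ≤ contentOf S (suc a)
    a+1-counted = ≤-trans (Occurs⇒count (suc a) r a+1-occurs) (sum-map-nth (count (suc a)) S k S[k]≡r)

  τ-range : ∀ v → 1 ≤ v → v ≤ ℓ → 1 ≤ τ a v × τ a v ≤ ℓ
  τ-range v 1≤v v≤ℓ with transpositionCase a v
  ... | at-a refl   rewrite τ-a a   = s≤s z≤n , a+1≤ℓ
  ... | at-a+1 refl rewrite τ-a+1 a = 1≤a , ≤-trans (n≤1+n a) a+1≤ℓ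
  ... | fixed v≢a v≢a+1 rewrite τ-other a v≢a v≢a+1 = 1≤v , v≤ℓ

  content-U-Δ : ∀ v → 1 ≤ v → v ≤ ℓ → ℤ.+ contentOf U v ≡ Δ μ (sσ a σ) (posOf (sσ a σ) v)
  content-U-Δ v 1≤v v≤ℓ = begin
    ℤ.+ contentOf U v                                    ≡⟨ content-transfer _ _ _ v w p (content-U v) content-w ⟩
    (ℤ.+ get₁ μ p ℤ.+ ℤ.+ v) ℤ.- ℤ.+ p                   ≡⟨ cong (λ z → (ℤ.+ get₁ μ p ℤ.+ ℤ.+ z) ℤ.- ℤ.+ p) (sym σ′[p]≡v) ⟩
    Δ μ (sσ a σ) p                                       ≡⟨ cong (Δ μ (sσ a σ)) (sym (posOf-sσ a σ v)) ⟩
    Δ μ (sσ a σ) (posOf (sσ a σ) v)                      ∎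
    where
    open ≡-Reasoning
    w = τ a v
    p = posOf σ w
    1≤w = proj₁ (τ-range v 1≤v v≤ℓ)
    w≤ℓ = proj₂ (τ-range v 1≤v v≤ℓ)
    σ[p]≡w : get₁ σ p ≡ w
    σ[p]≡w = get₁-posOf σ w (count⇒Occurs w σ (≤-reflexive (sym (IsPerm-count σ-perm w 1≤w w≤ℓ))))
    σ′[p]≡v : get₁ (sσ a σ) p ≡ v
    σ′[p]≡v = trans (get₁-sσ a σ p 1≤a) (trans (cong (τ a) σ[p]≡w) (τ-involutive a v))
    content-w : ℤ.+ contentOf S w ≡ (ℤ.+ get₁ μ p ℤ.+ ℤ.+ w) ℤ.- ℤ.+ p
    content-w = trans (content-S-Δ w 1≤w w≤ℓ)
                      (cong (λ z → (ℤ.+ get₁ μ p ℤ.+ ℤ.+ z) ℤ.- ℤ.+ p) σ[p]≡w)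

  content-U-0 : ∀ v → ℓ < v → contentOf U v ≡ 0
  content-U-0 v ℓ<v =
    trans (+-cancelʳ-≡ v _ _ (subst (λ w → contentOf U v + w ≡ contentOf S w + v) (τ-other a v≢a v≢a+1) (content-U v)))
          (content-S-0 v ℓ<v)
    where
    v≢a : v ≢ a
    v≢a refl = <⇒≱ ℓ<v (≤-trans (n≤1+n a) a+1≤ℓ)
    v≢a+1 : v ≢ suc a
    v≢a+1 refl = <⇒≱ ℓ<v a+1≤ℓ

  inB-U : InB λ' μ (U , sσ a σ)
  inB-U = IsSSYT-U , IsPerm-sσ ℓ a σ σ-perm 1≤a a+1≤ℓ , content-U-Δ , content-U-0

  sgn-U : sgn (sσ a σ) ≡ - sgn σ
  sgn-U = sgn-sσ a σ (IsPerm-count σ-perm a 1≤a (≤-trans (n≤1+n a) a+1≤ℓ)) (IsPerm-count σ-perm (suc a) (s≤s z≤n) a+1≤ℓ)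

  U-above : ∀ {i} → i < k → nth U i ≡ nth S i
  U-above {i} i<k = begin
    nth U i                            ≡⟨ cong (λ X → nth X i) U≡ ⟩
    nth (map (flipRow P a) S′) i       ≡⟨ nth-map _ S′ i ⟩
    Maybe.map (flipRow P a) (nth S′ i) ≡⟨ cong (Maybe.map _) (nth-updRow-≢ k _ S i (<⇒≢ i<k)) ⟩
    Maybe.map (flipRow P a) (nth S i)  ≡⟨ unchanged (nth S i) refl ⟩
    nth S i                            ∎
    where
    open ≡-Reasoning
    unchanged : ∀ m → nth S i ≡ m → Maybe.map (flipRow P a) m ≡ m
    unchanged nothing   _    = refl
    unchanged (just rᵢ) S[i] = cong just (flipFrom-uninvolved P a _ 0 rᵢ (nth⇒All rᵢ λ j e →
      let x<a = above-<a j i<k (trans (entry-just S i j S[i]) e) in ≢⇒uninvolved (<⇒≢ x<a) (<⇒≢ (≤-trans x<a (n≤1+n a)))))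

  U[k] : nth U k ≡ just (flipRow P a r′)
  U[k] = trans (cong (λ X → nth X k) U≡) (nth-map-just _ S′ k S′[k]≡r′)

  last-U[k] : lastOr0 (flipRow P a r′) ≡ suc a
  last-U[k] = ≤-antisym (All-nth (proj₁ last-occ) bounded (proj₂ last-occ)) (lastOr0-max u (proj₁ a+1∈u) sorted (proj₂ a+1∈u))
    where
    u = flipRow P a r′
    sorted : Linked _≤_ u
    sorted = All-nth k (proj₁ (proj₂ ssU)) U[k]
    bounded : All (_≤ suc a) u
    bounded = nth⇒All u λ j e → case nth-flipFrom⁻ P a _ 0 r′ j e of λ
      { (x , ex , t , refl) → flipEntry-≤a+1 (P j) a (#free-a+1 P a r′) t x (All-nth j (replaceLeftmost-All a r (n≤1+n a) r-≤a+1) ex) }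
    last-occ : Occurs (lastOr0 u) u
    last-occ = lastOr0-occurs u (subst (1 ≤_) (sym (trans (length-flipFrom P a _ 0 r′) (length-replaceLeftmost (suc a) r)))
                                        r-nonempty)
    a+1∈u : Occurs (suc a) u
    a+1∈u = count⇒Occurs (suc a) u (subst (1 ≤_) (sym (count-a+1-flipRow P a r′))
              (≤-trans (subst (1 ≤_) (sym (#free-a-replaceLeftmost P a r a+1-unpaired a+1-occurs)) (s≤s z≤n))
                       (m≤n+m _ (#paired-a+1 P a r′))))

  mismatch-U : FirstMismatch 1 U k
  mismatch-U = record
    { before  = λ k′<k e → before k′<k (trans (sym (U-above k′<k)) e)
    ; row     = flipRow P a r′
    ; at      = U[k]
    ; differs = λ a+1≡k+1 → <⇒≢ k<a (sym (suc-injective (trans (sym last-U[k]) a+1≡k+1)))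
    }

  lower-U : updRow (suc k) (replaceLeftmost (suc a)) U ≡ flipRows a S
  lower-U = nth-ext _ _ λ i → case i ≟ k of λ
    { (yes refl) → trans (nth-updRow k _ U) (trans (cong (Maybe.map _) U[k])
                     (trans (cong just (replaceLeftmost-flipRow P a r a+1-unpaired a+1-occurs)) (sym (nth-map-just _ S k S[k]≡r))))
    ; (no i≢k)   → trans (nth-updRow-≢ k _ U i i≢k) (trans (cong (λ X → nth X i) U≡) (trans (nth-map _ S′ i)
                     (trans (cong (Maybe.map _) (nth-updRow-≢ k _ S i i≢k)) (sym (nth-map _ S i))))) }

  χ-S : χ λ' μ (S , σ) ≡ (U , sσ a σ)
  χ-S = χ-moves λ' μ S σ mismatch (sym a+1≡last) moves

  χ-U : χ λ' μ (U , sσ a σ) ≡ (S , σ)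
  χ-U = trans (χ-moves λ' μ U (sσ a σ) mismatch-U last-U[k] moves)
              (cong₂ _,_ (trans (cong (BK a) lower-U) (trans (BK≡flipRows a (flipRows a S)) (flipRows-involutive ssS a)))
                         (sσ-involutive a σ))

  involution : SignReversingInvolutionAt (InB λ' μ) (χ λ' μ) (S , σ)
  involution = swapped {InB λ' μ} {χ λ' μ} χ-S χ-U inB-U sgn-U

theorem3p9 : (n : ℕ) (λ' μ : List ℕ) → IsPartition n λ' → IsPartition n μ → λ' ≢ μ →
    (p : Pair) → InB λ' μ p →
      InB λ' μ (χ λ' μ p)
      × χ λ' μ (χ λ' μ p) ≡ p
      × (χ λ' μ p ≢ p → sgn (proj₂ (χ λ' μ p)) ≡ - sgn (proj₂ p))
theorem3p9 n λ' μ λ-partition _ _ (S , σ) inB with findM λ' S ≟ length λ' | findFrom-cases λ' S 1 S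
... | yes m≡ℓ | _                          = fixed-point {InB λ' μ} {χ λ' μ} (χ-fixed λ' μ S σ m≡ℓ) inB
... | no m≢ℓ  | inj₁ m≡ℓ                   = contradiction m≡ℓ m≢ℓ
... | no m≢ℓ  | inj₂ (k , m≡1+k , mismatch) = Move.involution λ-partition inB mismatch (subst (_≢ length λ') m≡1+k m≢ℓ)
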